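{- Let $n\geq3$ and define $\eta:\mathcal{J}(\mathcal{L}_n)\to\mathcal{L}_{n+1}$ by \[\eta(\vec\alpha)=\begin{cases}\vec\alpha^{\downarrow_1}&\text{if }\vec\alpha\in\mathrm{Cl}(n)\cup\mathrm{NP}(n),\\ \vec\alpha^{\downarrow_2}&\text{if }\vec\alpha\in\mathrm{Ss}(n)\cup\mathrm{NS}(n),\\ \vec\alpha^{\downarrow_{l+2}}&\text{if }\vec\alpha\in\mathrm{PP}_l(n)\text{ for some }1\leq l<n.\end{cases}\] Then $\mathcal{J}(\mathcal{L}_{n+1})\setminus\eta(\mathcal{J}(\mathcal{L}_n))=E_1\cup E_2$, where $E_1=\{(2,1,\ldots,1)\}$ consists of the partition of $n+1$ with one part $2$ and $n-1$ parts $1$, and $E_2$ is the set of partitions of $n+1$ of the form $(3,\ldots,3,1,\ldots,1)$ with $m\geq1$ parts equal to $3$ followed by $l\geq1$ parts equal to $1$.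
   Context: A partition of a positive integer $n$ is an $n$-tuple $\vec\alpha=(a_1,\ldots,a_n)$ of natural numbers with $a_1\geq\cdots\geq a_n\geq0$ and $\sum a_i=n$ (trailing zeros may be omitted; $a_i=0$ for $i>n$). The dominance ordering: $(a_i)\geq(b_i)$ iff $\sum_{i=1}^j a_i\geq\sum_{i=1}^j b_i$ for all $j\geq1$; partitions of $n$ form a lattice $\mathcal{L}_n$, and $\mathcal{J}(\mathcal{L}_n)$ is its set of join-irreducible elements (elements covering exactly one element). Every element of $\mathcal{J}(\mathcal{L}_n)$ lies in exactly one of the cases defining $\eta$. For $i\in\{1,\ldots,n\}$, $\vec\alpha^{\downarrow_i}=(a_1,\ldots,a_i+1,\ldots,a_n,0)$ and $\vec\alpha^{\downarrow_{n+1}}=(a_1,\ldots,a_n,1)$. Let $d_j(\vec\alpha)=a_j-a_{j+1}$. $\vec\alpha$ has a cliff at $j$ if $d_j(\vec\alpha)\geq2$; a slippery plateau of length $k-j$ at $j$ if there is $k>j$ with $d_i(\vec\alpha)=0$ for $i\in\{j,\ldots,k-1\}$ and $d_k(\vec\alpha)=1$; a non-slippery plateau at $j$ if there is $k>j$ with $d_i(\vec\alpha)=0$ for $i\in\{j,\ldots,k-1\}$ and a cliff at $k$; a slippery (resp. non-slippery) step at $j$ if $(a_1,\ldots,a_j-1,\ldots,a_n)$ is a partition with a slippery (resp. non-slippery) plateau at $j$. $\mathrm{Cl}(n)$, $\mathrm{Ss}(n)$, $\mathrm{NS}(n)$, $\mathrm{PP}_l(n)$, $\mathrm{NP}(n)$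 are the sets of partitions of $n$ having, respectively, a cliff at $1$, a slippery step at $1$, a non-slippery step at $1$, a slippery plateau of length $l$ at $1$, a non-slippery plateau at $1$. -}

module Defs where

open import Data.Nat using (ℕ; zero; suc; _+_; _*_; _∸_; _≤_; _<_; _≤?_)
open import Data.List using (List; []; _∷_; take; replicate; _++_)
open import Data.Nat.ListAction using (sum)
open import Data.Vec using (Vec; []; _∷_; toList; _∷ʳ_)
open import Data.Product using (Σ; ∃; _×_; _,_)
open import Data.Sum using (_⊎_)
open import Relation.Nullary using (¬_; yes; no)
open import Relation.Binary.PropositionalEquality using (_≡_; _≢_)

at : List ℕ → ℕ → ℕ
at [] _ = 0
at (x ∷ xs) zero = x
at (x ∷ xs) (suc i) = at xs i

-- 1-indexed entry a_i of a tuple; a_i = 0 for i beyond the length.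
-- (index 0 is junk and never used)
_!_ : ∀ {k} → Vec ℕ k → ℕ → ℕ
v ! zero = 0
v ! suc i = at (toList v) i

NonIncr : ∀ {k} → Vec ℕ k → Set
NonIncr v = ∀ i → v ! suc (suc i) ≤ v ! suc i

-- v is a partition of m (as a k-tuple with trailing zeros allowed).
IsPartition : ∀ {k} → ℕ → Vec ℕ k → Set
IsPartition m v = NonIncr v × sum (toList v) ≡ m

psum : ∀ {k} → Vec ℕ k → ℕ → ℕ
psum v j = sum (take j (toList v))

_⊴_ : ∀ {k} → Vec ℕ k → Vec ℕ k → Set
β ⊴ α = ∀ j → 1 ≤ j → psum β j ≤ psum α j

-- α covers β in the lattice L_n of partitions of n (n-tuples)
Covers : (n : ℕ) → Vec ℕ n → Vec ℕ n → Set
Covers n α β =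
  IsPartition n β × β ⊴ α × β ≢ α ×
  (∀ γ → IsPartition n γ → β ⊴ γ → γ ⊴ α → γ ≡ β ⊎ γ ≡ α)

-- join-irreducible elements of L_n: cover exactly one element
JoinIrr : (n : ℕ) → Vec ℕ n → Set
JoinIrr n α =
  IsPartition n α × Σ (Vec ℕ n) λ β → Covers n α β × (∀ γ → Covers n α γ → γ ≡ β)

d : ∀ {k} → Vec ℕ k → ℕ → ℕ
d v j = v ! j ∸ v ! suc j

Cliff : ∀ {k} → Vec ℕ k → ℕ → Set
Cliff v j = 2 ≤ d v j

SlipPlateau : ∀ {k} → Vec ℕ k → ℕ → ℕ → Set
SlipPlateau v j L = Σ ℕ λ k → j < k × L ≡ k ∸ j ×
  (∀ i → j ≤ i → i < k → d v i ≡ 0) × d v k ≡ 1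

NonSlipPlateau : ∀ {k} → Vec ℕ k → ℕ → Set
NonSlipPlateau v j = Σ ℕ λ k → j < k ×
  (∀ i → j ≤ i → i < k → d v i ≡ 0) × Cliff v k

-- decrement / increment the 1-indexed entry i (index 0: unchanged, junk)
decAt : ∀ {k} → Vec ℕ k → ℕ → Vec ℕ k
decAt [] _ = []
decAt (x ∷ xs) zero = x ∷ xs
decAt (x ∷ xs) (suc zero) = (x ∸ 1) ∷ xs
decAt (x ∷ xs) (suc (suc i)) = x ∷ decAt xs (suc i)

incAt : ∀ {k} → Vec ℕ k → ℕ → Vec ℕ k
incAt [] _ = []
incAt (x ∷ xs) zero = x ∷ xs
incAt (x ∷ xs) (suc zero) = suc x ∷ xs
incAt (x ∷ xs) (suc (suc i)) = x ∷ incAt xs (suc i)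

SlipStep : (n : ℕ) → Vec ℕ n → ℕ → Set
SlipStep n v j = 1 ≤ v ! j × IsPartition (n ∸ 1) (decAt v j) ×
  Σ ℕ λ L → SlipPlateau (decAt v j) j L

NonSlipStep : (n : ℕ) → Vec ℕ n → ℕ → Set
NonSlipStep n v j = 1 ≤ v ! j × IsPartition (n ∸ 1) (decAt v j) ×
  NonSlipPlateau (decAt v j) j

Cl Ss NS NP : (n : ℕ) → Vec ℕ n → Set
Cl n v = Cliff v 1
Ss n v = SlipStep n v 1
NS n v = NonSlipStep n v 1
NP n v = NonSlipPlateau v 1

PP : ℕ → (n : ℕ) → Vec ℕ n → Set
PP l n v = SlipPlateau v 1 l

down : ∀ {n} → Vec ℕ n → ℕ → Vec ℕ (suc n)
down {n} v i with i ≤? n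
... | yes _ = incAt v i ∷ʳ 0
... | no _  = v ∷ʳ 1

-- graph of η : J(L_n) → L_{n+1}  (η α ≡ γ  iff  EtaGraph n α γ, for α ∈ J(L_n))
EtaGraph : (n : ℕ) → Vec ℕ n → Vec ℕ (suc n) → Set
EtaGraph n α γ =
  ((Cl n α ⊎ NP n α) × γ ≡ down α 1) ⊎
  ((Ss n α ⊎ NS n α) × γ ≡ down α 2) ⊎
  (Σ ℕ λ l → 1 ≤ l × l < n × PP l n α × γ ≡ down α (l + 2))

-- E_1 = {(2,1,…,1)} ⊆ L_{n+1}  (one part 2, n-1 parts 1, then a trailing 0)
E1 : (n : ℕ) → Vec ℕ (suc n) → Set
E1 n γ = toList γ ≡ 2 ∷ (replicate (n ∸ 1) 1 ++ 0 ∷ [])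

E2 : (n : ℕ) → Vec ℕ (suc n) → Set
E2 n γ = Σ ℕ λ m → Σ ℕ λ l → 1 ≤ m × 1 ≤ l × 3 * m + l ≡ suc n ×
  toList γ ≡ replicate m 3 ++ replicate l 1 ++ replicate (suc n ∸ (m + l)) 0

{-# OPTIONS --safe #-}
-- A partition V is join-irreducible in the dominance lattice iff the partitions strictly below
-- V have a greatest element. Moving one cell from the last row of a block of V to the first row
-- of a later block gives a partition below V; when V admits two independent such moves, their
-- results have join V. This leaves the shapes a^p, a^p 1^r (a ≥ 3), a^p (a-1)^q and
-- a^p (a-1)^q 1^r (a ≥ 4), and for each of them one particular move is the greatest partition
-- below V, since a partition below V with the same prefix sum at the start of a block on which
-- V is flat must agree with V up to the end of that block. The map η adds one cell; conversely,
-- removing from a join-irreducible γ of n + 1 the last cell of its first block leaves α with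
-- η α = γ, and α is join-irreducible except exactly when γ is (2, 1, …, 1) or 3^m 1^l.
module Submission where

open import Defs
open import Data.Nat using (ℕ; zero; suc; _+_; _*_; _∸_; _≤_; _<_; _≤?_; _<?_; _≟_; z≤n; s≤s)
open import Data.Nat.Properties
open import Data.Nat.ListAction using (sum)
open import Data.List using (List; []; _∷_; take; replicate; _++_; length)
open import Data.List.Properties using (length-++; length-replicate)
open import Data.Vec using (Vec; []; _∷_; toList; _∷ʳ_)
open import Data.Vec.Properties using (≡-dec; length-toList)
open import Data.Product using (Σ; _×_; _,_; proj₁; proj₂)
open import Data.Sum using (_⊎_; inj₁; inj₂)
open import Data.Empty using (⊥; ⊥-elim)
open import Relation.Nullary using (¬_; Dec; yes; no; contradiction)
open import Relation.Nullary.Decidable using (¬¬-excluded-middle)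
open import Relation.Binary.PropositionalEquality
open import Function.Bundles using (_⇔_; mk⇔)

-- row v i is the paper's a_{i+1}: from here on all row indices are 0-based.
row : ∀ {k} → Vec ℕ k → ℕ → ℕ
row v = at (toList v)

sumBelow : (ℕ → ℕ) → ℕ → ℕ
sumBelow f zero = 0
sumBelow f (suc j) = sumBelow f j + f j

sumBelow-suc : ∀ f j → sumBelow f (suc j) ≡ f 0 + sumBelow (λ i → f (suc i)) j
sumBelow-suc f zero = +-comm 0 (f 0)
sumBelow-suc f (suc j) = trans (cong (_+ f (suc j)) (sumBelow-suc f j)) (+-assoc (f 0) _ _)

sumBelow-cong : ∀ f g j → (∀ i → i < j → f i ≡ g i) → sumBelow f j ≡ sumBelow g j
sumBelow-cong f g zero h = refl
sumBelow-cong f g (suc j) h =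
  cong₂ _+_ (sumBelow-cong f g j (λ i lt → h i (m≤n⇒m≤1+n lt))) (h j ≤-refl)

sumBelow-mono : ∀ f g j → (∀ i → i < j → f i ≤ g i) → sumBelow f j ≤ sumBelow g j
sumBelow-mono f g zero h = z≤n
sumBelow-mono f g (suc j) h =
  +-mono-≤ (sumBelow-mono f g j (λ i lt → h i (m≤n⇒m≤1+n lt))) (h j ≤-refl)

sumBelow-zero : ∀ j → sumBelow (at []) j ≡ 0
sumBelow-zero zero = refl
sumBelow-zero (suc j) = cong (_+ 0) (sumBelow-zero j)

sum-take : (xs : List ℕ) (j : ℕ) → sum (take j xs) ≡ sumBelow (at xs) j
sum-take xs zero = refl
sum-take [] (suc j) = sym (cong (_+ 0) (sumBelow-zero j))
sum-take (x ∷ xs) (suc j) =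
  trans (cong (x +_) (sum-take xs j)) (sym (sumBelow-suc (at (x ∷ xs)) j))

psum≡sumBelow : ∀ {k} (v : Vec ℕ k) j → psum v j ≡ sumBelow (row v) j
psum≡sumBelow v = sum-take (toList v)

sum≡sumBelow : ∀ {k} (v : Vec ℕ k) → sum (toList v) ≡ sumBelow (row v) k
sum≡sumBelow [] = refl
sum≡sumBelow {suc k} (x ∷ v) =
  trans (cong (x +_) (sum≡sumBelow v)) (sym (sumBelow-suc (row (x ∷ v)) k))

row-beyond : ∀ {k} (v : Vec ℕ k) i → k ≤ i → row v i ≡ 0
row-beyond [] i _ = refl
row-beyond (x ∷ v) (suc i) (s≤s le) = row-beyond v i le

rows⇒≡ : ∀ {k} (u w : Vec ℕ k) → (∀ i → i < k → row u i ≡ row w i) → u ≡ w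
rows⇒≡ [] [] _ = refl
rows⇒≡ (x ∷ u) (y ∷ w) h =
  cong₂ _∷_ (h 0 (s≤s z≤n)) (rows⇒≡ u w (λ i lt → h (suc i) (s≤s lt)))

fromFun : (k : ℕ) → (ℕ → ℕ) → Vec ℕ k
fromFun zero f = []
fromFun (suc k) f = f 0 ∷ fromFun k (λ i → f (suc i))

row-fromFun< : ∀ k f i → i < k → row (fromFun k f) i ≡ f i
row-fromFun< (suc k) f zero _ = refl
row-fromFun< (suc k) f (suc i) (s≤s lt) = row-fromFun< k (λ i → f (suc i)) i lt

row-fromFun : ∀ k f → (∀ i → k ≤ i → f i ≡ 0) → ∀ i → row (fromFun k f) i ≡ f i
row-fromFun k f hz i with i <? k
... | yes lt = row-fromFun< k f i lt
... | no ge = trans (row-beyond (fromFun k f) i (≮⇒≥ ge)) (sym (hz i (≮⇒≥ ge)))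

sumBelow-< : ∀ f g i P → sumBelow f i ≡ sumBelow g i → (∀ x → i ≤ x → x < P → f x ≤ g x) →
  f i < g i → i < P → sumBelow f P < sumBelow g P
sumBelow-< f g i (suc P) eq h lt (s≤s iP) with m≤n⇒m<n∨m≡n iP
... | inj₂ refl = subst (λ z → z + f i < sumBelow g i + g i) (sym eq) (+-monoʳ-< (sumBelow g i) lt)
... | inj₁ iP' = +-mono-<-≤ (sumBelow-< f g i P eq (λ x a b → h x a (m≤n⇒m≤1+n b)) lt iP') (h P iP ≤-refl)

sumBelow-stable : ∀ f k j → (∀ i → k ≤ i → f i ≡ 0) → k ≤ j → sumBelow f j ≡ sumBelow f k
sumBelow-stable f k j hz le with m≤n⇒m<n∨m≡n le
... | inj₂ refl = refl
sumBelow-stable f k (suc j) hz le | inj₁ (s≤s lt) =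
  trans (cong (sumBelow f j +_) (hz j lt)) (trans (+-identityʳ _) (sumBelow-stable f k j hz lt))

sumBelow-step-≤ : ∀ f g i → sumBelow f i ≡ sumBelow g i →
  sumBelow f (suc i) ≤ sumBelow g (suc i) → f i ≤ g i
sumBelow-step-≤ f g i eq le =
  +-cancelˡ-≤ (sumBelow g i) _ _ (subst (λ z → z + f i ≤ sumBelow g i + g i) eq le)

sumBelow-injective : ∀ f g → (∀ j → sumBelow f j ≡ sumBelow g j) → ∀ i → f i ≡ g i
sumBelow-injective f g h i =
  +-cancelˡ-≡ (sumBelow f i) _ _ (trans (h (suc i)) (cong (_+ g i) (sym (h i))))

NonIncreasing : (ℕ → ℕ) → Set
NonIncreasing f = ∀ i → f (suc i) ≤ f i

nonIncreasing-≤ : ∀ f → NonIncreasing f → ∀ i x → i ≤ x → f x ≤ f i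
nonIncreasing-≤ f ni i x le with m≤n⇒m<n∨m≡n le
... | inj₂ refl = ≤-refl
nonIncreasing-≤ f ni i (suc x) le | inj₁ (s≤s lt) = ≤-trans (ni x) (nonIncreasing-≤ f ni i x lt)

_≼_ : (ℕ → ℕ) → (ℕ → ℕ) → Set
g ≼ h = ∀ j → sumBelow g j ≤ sumBelow h j

Flat : (ℕ → ℕ) → ℕ → ℕ → Set
Flat f lo hi = ∀ x y → lo ≤ x → lo ≤ y → x < hi → y < hi → f x ≤ suc (f y)

-- At the first row i where b and v differ, b i < v i; as b is non-increasing and v is flat on
-- the block containing i, b stays below v up to the end of that block, so the prefix sums
-- cannot agree there.
flat-blocks-rigid : ∀ N p b v → NonIncreasing b → b ≼ v →
  sumBelow b p ≡ sumBelow v p → sumBelow b N ≡ sumBelow v N → p ≤ N →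
  Flat v 0 p → Flat v p N → ∀ i → i < N → b i ≡ v i
flat-blocks-rigid N p b v ni b≼v eqp eqN p≤N flat₁ flat₂ i i<N = go (suc i) i<N i ≤-refl
  where
  deficit-persists : ∀ i P → sumBelow b i ≡ sumBelow v i → b i < v i → i < P →
    (∀ x → i ≤ x → x < P → v i ≤ suc (v x)) → sumBelow b P < sumBelow v P
  deficit-persists i P eqi lt iP flat = sumBelow-< b v i P eqi
    (λ x ix xP → ≤-pred (≤-trans (s≤s (nonIncreasing-≤ b ni i x ix)) (≤-trans lt (flat x ix xP)))) lt iP
  agree : ∀ i → i < N → sumBelow b i ≡ sumBelow v i → b i ≡ v i
  agree i iN eqi with m≤n⇒m<n∨m≡n (sumBelow-step-≤ b v i eqi (b≼v (suc i)))
  ... | inj₂ e = e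
  ... | inj₁ lt with i <? p
  ...   | yes ip = ⊥-elim (<-irrefl eqp (deficit-persists i p eqi lt ip
            (λ x _ xp → flat₁ i x z≤n z≤n ip xp)))
  ...   | no ip = ⊥-elim (<-irrefl eqN (deficit-persists i N eqi lt iN
            (λ x ix xN → flat₂ i x (≮⇒≥ ip) (≤-trans (≮⇒≥ ip) ix) iN xN)))
  go : ∀ i → i ≤ N → ∀ i' → i' < i → b i' ≡ v i'
  go (suc i) iN i' lt with m≤n⇒m<n∨m≡n lt
  ... | inj₁ (s≤s lt') = go i (≤-trans (n≤1+n i) iN) i' lt'
  ... | inj₂ refl = agree i iN (sumBelow-cong b v i (go i (≤-trans (n≤1+n i) iN)))

⊴⇒≼ : ∀ {k} (β α : Vec ℕ k) → β ⊴ α → row β ≼ row α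
⊴⇒≼ β α β⊴α zero = z≤n
⊴⇒≼ β α β⊴α (suc j) =
  subst₂ _≤_ (psum≡sumBelow β (suc j)) (psum≡sumBelow α (suc j)) (β⊴α (suc j) (s≤s z≤n))

≼⇒⊴ : ∀ {k} (β α : Vec ℕ k) → row β ≼ row α → β ⊴ α
≼⇒⊴ β α β≼α j _ = subst₂ _≤_ (sym (psum≡sumBelow β j)) (sym (psum≡sumBelow α j)) (β≼α j)

⊴-antisym : ∀ {k} (u w : Vec ℕ k) → u ⊴ w → w ⊴ u → u ≡ w
⊴-antisym u w u⊴w w⊴u = rows⇒≡ u w (λ i _ → sumBelow-injective (row u) (row w)
  (λ j → ≤-antisym (⊴⇒≼ u w u⊴w j) (⊴⇒≼ w u w⊴u j)) i)

⊴-refl : ∀ {k} (u : Vec ℕ k) → u ⊴ u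
⊴-refl u j _ = ≤-refl

⊴-trans : ∀ {k} (u v w : Vec ℕ k) → u ⊴ v → v ⊴ w → u ⊴ w
⊴-trans u v w u⊴v v⊴w j h = ≤-trans (u⊴v j h) (v⊴w j h)

IsPartitionᶠ : ℕ → (ℕ → ℕ) → Set
IsPartitionᶠ N f = NonIncreasing f × sumBelow f N ≡ N × (∀ i → N ≤ i → f i ≡ 0)

row-isPartitionᶠ : ∀ {N} (v : Vec ℕ N) → IsPartition N v → IsPartitionᶠ N (row v)
row-isPartitionᶠ {N} v (ni , s) = ni , trans (sym (sum≡sumBelow v)) s , λ i le → row-beyond v i le

fromFun-isPartition : ∀ N f → IsPartitionᶠ N f → IsPartition N (fromFun N f)
fromFun-isPartition N f (ni , s , hz) =
  (λ i → subst₂ _≤_ (sym (row-fromFun N f hz (suc i))) (sym (row-fromFun N f hz i)) (ni i)) ,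
  trans (sum≡sumBelow (fromFun N f)) (trans (sumBelow-cong _ _ N (row-fromFun< N f)) s)

StrictlyBelow : (N : ℕ) → Vec ℕ N → Vec ℕ N → Set
StrictlyBelow N β α = IsPartition N β × β ⊴ α × β ≢ α

joinIrr-of-greatest-below : ∀ N (V c : Vec ℕ N) → IsPartition N V → StrictlyBelow N c V →
  (∀ β → StrictlyBelow N β V → β ⊴ c) → JoinIrr N V
joinIrr-of-greatest-below N V c pV (pc , c⊴V , c≢V) greatest =
  pV , c , (pc , c⊴V , c≢V , between) , unique
  where
  between : ∀ γ → IsPartition N γ → c ⊴ γ → γ ⊴ V → γ ≡ c ⊎ γ ≡ V
  between γ pγ c⊴γ γ⊴V with ≡-dec _≟_ γ V
  ... | yes e = inj₂ e
  ... | no ne = inj₁ (⊴-antisym γ c (greatest γ (pγ , γ⊴V , ne)) c⊴γ)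
  unique : ∀ γ → Covers N V γ → γ ≡ c
  unique γ (pγ , γ⊴V , γ≢V , cover) with cover c pc (greatest γ (pγ , γ⊴V , γ≢V)) c⊴V
  ... | inj₁ e = sym e
  ... | inj₂ e = ⊥-elim (c≢V e)

δ : ℕ → ℕ → ℕ
δ zero zero = 1
δ zero (suc x) = 0
δ (suc i) zero = 0
δ (suc i) (suc x) = δ i x

δ-refl : ∀ i → δ i i ≡ 1
δ-refl zero = refl
δ-refl (suc i) = δ-refl i

δ-≢ : ∀ i x → i ≢ x → δ i x ≡ 0
δ-≢ zero zero ne = ⊥-elim (ne refl)
δ-≢ zero (suc x) ne = refl
δ-≢ (suc i) zero ne = refl
δ-≢ (suc i) (suc x) ne = δ-≢ i x (λ e → ne (cong suc e))

moveCell : (ℕ → ℕ) → ℕ → ℕ → ℕ → ℕ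
moveCell f i j x = f x ∸ δ i x + δ j x

moveCell-other : ∀ f i j x → x ≢ i → x ≢ j → moveCell f i j x ≡ f x
moveCell-other f i j x x≢i x≢j
  rewrite δ-≢ i x (λ e → x≢i (sym e)) | δ-≢ j x (λ e → x≢j (sym e)) = +-identityʳ (f x)

moveCell-source : ∀ f i j → i ≢ j → moveCell f i j i ≡ f i ∸ 1
moveCell-source f i j i≢j rewrite δ-refl i | δ-≢ j i (λ e → i≢j (sym e)) = +-identityʳ _

moveCell-target : ∀ f i j → i ≢ j → moveCell f i j j ≡ suc (f j)
moveCell-target f i j i≢j rewrite δ-refl j | δ-≢ i j i≢j = +-comm (f j) 1

sumBelow-moveCell-before : ∀ f i j q → i < j → q ≤ i → sumBelow (moveCell f i j) q ≡ sumBelow f q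
sumBelow-moveCell-before f i j q i<j q≤i = sumBelow-cong _ _ q (λ x x<q →
  moveCell-other f i j x (<⇒≢ (<-≤-trans x<q q≤i)) (<⇒≢ (<-trans (<-≤-trans x<q q≤i) i<j)))

sumBelow-moveCell-between : ∀ f i j q → 1 ≤ f i → i < j → i < q → q ≤ j →
  suc (sumBelow (moveCell f i j) q) ≡ sumBelow f q
sumBelow-moveCell-between f i j (suc q) fi i<j (s≤s i≤q) q<j with m≤n⇒m<n∨m≡n i≤q
... | inj₂ refl = begin
    suc (sumBelow (moveCell f i j) i + moveCell f i j i)
      ≡⟨ cong₂ (λ a b → suc (a + b)) (sumBelow-moveCell-before f i j i i<j ≤-refl)
                                     (moveCell-source f i j (<⇒≢ i<j)) ⟩
    suc (sumBelow f i + (f i ∸ 1)) ≡⟨ sym (+-suc (sumBelow f i) (f i ∸ 1)) ⟩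
    sumBelow f i + suc (f i ∸ 1)   ≡⟨ cong (sumBelow f i +_) (trans (+-comm 1 (f i ∸ 1)) (m∸n+n≡m fi)) ⟩
    sumBelow f i + f i ∎
  where open ≡-Reasoning
... | inj₁ i<q = cong₂ _+_
  (sumBelow-moveCell-between f i j q fi i<j i<q (≤-trans (n≤1+n q) q<j))
  (moveCell-other f i j q (>⇒≢ i<q) (<⇒≢ q<j))

sumBelow-moveCell-after : ∀ f i j q → 1 ≤ f i → i < j → j < q →
  sumBelow (moveCell f i j) q ≡ sumBelow f q
sumBelow-moveCell-after f i j (suc q) fi i<j (s≤s j≤q) with m≤n⇒m<n∨m≡n j≤q
... | inj₂ refl = begin
    sumBelow (moveCell f i j) j + moveCell f i j j
      ≡⟨ cong (sumBelow (moveCell f i j) j +_) (moveCell-target f i j (<⇒≢ i<j)) ⟩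
    sumBelow (moveCell f i j) j + suc (f j) ≡⟨ +-suc _ _ ⟩
    suc (sumBelow (moveCell f i j) j) + f j
      ≡⟨ cong (_+ f j) (sumBelow-moveCell-between f i j j fi i<j i<j ≤-refl) ⟩
    sumBelow f j + f j ∎
  where open ≡-Reasoning
... | inj₁ j<q = cong₂ _+_ (sumBelow-moveCell-after f i j q fi i<j j<q)
  (moveCell-other f i j q (>⇒≢ (<-trans i<j j<q)) (>⇒≢ j<q))

moveCell-≼ : ∀ f i j → 1 ≤ f i → i < j → moveCell f i j ≼ f
moveCell-≼ f i j fi i<j q with q ≤? i
... | yes q≤i = ≤-reflexive (sumBelow-moveCell-before f i j q i<j q≤i)
... | no q≰i with j <? q
...   | yes j<q = ≤-reflexive (sumBelow-moveCell-after f i j q fi i<j j<q)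
...   | no j≮q = ≤-trans (n≤1+n _)
          (≤-reflexive (sumBelow-moveCell-between f i j q fi i<j (≰⇒> q≰i) (≮⇒≥ j≮q)))

-- Row i is the last row of its block and row suc j the first of a later block, and they differ
-- by at least two, so moving one cell from row i to row suc j keeps the rows non-increasing.
Movable : ℕ → (ℕ → ℕ) → ℕ → ℕ → Set
Movable N f i j = i ≤ j × suc j < N × f (suc i) < f i × f (suc j) < f j × 2 + f (suc j) ≤ f i

movable-source-pos : ∀ {N f i j} → Movable N f i j → 1 ≤ f i
movable-source-pos (_ , _ , drop-i , _ , _) = ≤-trans (s≤s z≤n) drop-i

moveCell-nonIncreasing : ∀ N f i j → NonIncreasing f → Movable N f i j →
  NonIncreasing (moveCell f i (suc j))
moveCell-nonIncreasing N f i j ni (i≤j , _ , drop-i , drop-j , gap) x with x ≟ i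
... | yes refl with suc x ≟ suc j
...   | yes refl = subst₂ _≤_ (sym (moveCell-target f x (suc x) (<⇒≢ ≤-refl)))
                     (sym (moveCell-source f x (suc x) (<⇒≢ ≤-refl))) (∸-monoˡ-≤ 1 gap)
...   | no ne = subst₂ _≤_ (sym (moveCell-other f x (suc j) (suc x) (>⇒≢ ≤-refl) ne))
                     (sym (moveCell-source f x (suc j) (<⇒≢ (s≤s i≤j)))) (∸-monoˡ-≤ 1 drop-i)
moveCell-nonIncreasing N f i j ni (i≤j , _ , drop-i , drop-j , gap) x | no x≢i with x ≟ suc j
...   | yes refl = subst₂ _≤_
          (sym (moveCell-other f i (suc j) (suc (suc j)) (>⇒≢ (s≤s (≤-trans i≤j (n≤1+n _)))) (>⇒≢ ≤-refl)))
          (sym (moveCell-target f i (suc j) (<⇒≢ (s≤s i≤j)))) (≤-trans (ni (suc j)) (n≤1+n _))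
...   | no x≢j with suc x ≟ i
...     | yes refl = subst₂ _≤_ (sym (moveCell-source f (suc x) (suc j) (<⇒≢ (s≤s i≤j))))
          (sym (moveCell-other f (suc x) (suc j) x x≢i x≢j)) (≤-trans (m∸n≤m _ 1) (ni x))
...     | no sx≢i with suc x ≟ suc j
...       | yes refl = subst₂ _≤_ (sym (moveCell-target f i (suc x) (λ e → sx≢i (sym e))))
          (sym (moveCell-other f i (suc x) x x≢i x≢j)) drop-j
...       | no sx≢j = subst₂ _≤_ (sym (moveCell-other f i (suc j) (suc x) sx≢i sx≢j))
          (sym (moveCell-other f i (suc j) x x≢i x≢j)) (ni x)

moveCell-isPartitionᶠ : ∀ N f i j → IsPartitionᶠ N f → Movable N f i j →
  IsPartitionᶠ N (moveCell f i (suc j))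
moveCell-isPartitionᶠ N f i j (ni , s , hz) mv@(i≤j , j<N , _) =
  moveCell-nonIncreasing N f i j ni mv ,
  trans (sumBelow-moveCell-after f i (suc j) N (movable-source-pos mv) (s≤s i≤j) j<N) s ,
  λ x N≤x → trans (moveCell-other f i (suc j) x (>⇒≢ (<-≤-trans (<-trans (s≤s i≤j) j<N) N≤x))
                                                 (>⇒≢ (<-≤-trans j<N N≤x))) (hz x N≤x)

moved : ∀ N → Vec ℕ N → ℕ → ℕ → Vec ℕ N
moved N V i j = fromFun N (moveCell (row V) i (suc j))

module _ (N : ℕ) (V : Vec ℕ N) (i j : ℕ) (pV : IsPartition N V) (mv : Movable N (row V) i j) where

  private
    f = row V
    i≤j : i ≤ j
    i≤j = proj₁ mv
    fi : 1 ≤ f i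
    fi = movable-source-pos mv
    pmoved : IsPartitionᶠ N (moveCell f i (suc j))
    pmoved = moveCell-isPartitionᶠ N f i j (row-isPartitionᶠ V pV) mv

  sumBelow-moved : ∀ q → sumBelow (row (moved N V i j)) q ≡ sumBelow (moveCell f i (suc j)) q
  sumBelow-moved q = sumBelow-cong _ _ q (λ x _ → row-fromFun N _ (proj₂ (proj₂ pmoved)) x)

  moved-below : StrictlyBelow N (moved N V i j) V
  moved-below = fromFun-isPartition N _ pmoved ,
    ≼⇒⊴ _ V (λ q → ≤-trans (≤-reflexive (sumBelow-moved q)) (moveCell-≼ f i (suc j) fi (s≤s i≤j) q)) ,
    λ e → <-irrefl (trans (sym (sumBelow-moved (suc j))) (cong (λ w → sumBelow (row w) (suc j)) e))
                   (≤-reflexive (sumBelow-moveCell-between f i (suc j) (suc j) fi (s≤s i≤j) (s≤s i≤j) ≤-refl))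

  -- Any β < V has the prefix sums of V outside (i, suc j], and inside them it is one short of V
  -- unless, by flat-blocks-rigid, β is V itself; either way β lies below the moved partition.
  joinIrr-of-movable : (∀ q → i < q → q ≤ suc j → Flat f 0 q × Flat f q N) → JoinIrr N V
  joinIrr-of-movable flat = joinIrr-of-greatest-below N V (moved N V i j) pV moved-below greatest
    where
    greatest : ∀ β → StrictlyBelow N β V → β ⊴ moved N V i j
    greatest β (pβ , β⊴V , β≢V) = ≼⇒⊴ β _ β≼moved
      where
      pb : IsPartitionᶠ N (row β)
      pb = row-isPartitionᶠ β pβ
      β≼V : row β ≼ f
      β≼V = ⊴⇒≼ β V β⊴V
      β≼moved : row β ≼ row (moved N V i j)
      β≼moved q with q ≤? i
      ... | yes q≤i = ≤-trans (β≼V q)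
            (≤-reflexive (sym (trans (sumBelow-moved q) (sumBelow-moveCell-before f i (suc j) q (s≤s i≤j) q≤i))))
      ... | no q≰i with suc j <? q
      ...   | yes j<q = ≤-trans (β≼V q)
            (≤-reflexive (sym (trans (sumBelow-moved q) (sumBelow-moveCell-after f i (suc j) q fi (s≤s i≤j) j<q))))
      ...   | no j≮q with m≤n⇒m<n∨m≡n (β≼V q)
      ...     | inj₁ lt = ≤-trans (≤-pred (≤-trans lt (≤-reflexive (sym
                  (sumBelow-moveCell-between f i (suc j) q fi (s≤s i≤j) (≰⇒> q≰i) (≮⇒≥ j≮q))))))
                  (≤-reflexive (sym (sumBelow-moved q)))
      ...     | inj₂ eq = ⊥-elim (β≢V (rows⇒≡ β V (flat-blocks-rigid N q (row β) f (proj₁ pb) β≼V eq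
                  (trans (proj₁ (proj₂ pb)) (sym (proj₁ (proj₂ (row-isPartitionᶠ V pV)))))
                  (≤-trans (≮⇒≥ j≮q) (<⇒≤ (proj₁ (proj₂ mv)))) (proj₁ fl) (proj₂ fl))))
        where fl = flat q (≰⇒> q≰i) (≮⇒≥ j≮q)

potential : ∀ {N} → Vec ℕ N → ℕ
potential {N} x = sumBelow (sumBelow (row x)) (suc N)

+-≡-cancel-≤ : ∀ a b c d → a ≤ b → c ≤ d → a + c ≡ b + d → a ≡ b
+-≡-cancel-≤ a b c d a≤b c≤d e with m≤n⇒m<n∨m≡n a≤b
... | inj₂ p = p
... | inj₁ lt = ⊥-elim (<-irrefl e (+-mono-<-≤ lt c≤d))

≼-sumBelow-≡ : ∀ g h K → g ≼ h → sumBelow (sumBelow g) K ≡ sumBelow (sumBelow h) K →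
  ∀ j → j < K → sumBelow g j ≡ sumBelow h j
≼-sumBelow-≡ g h (suc K) g≼h e j j<K with m≤n⇒m<n∨m≡n (≤-pred j<K)
... | inj₁ lt = ≼-sumBelow-≡ g h K g≼h
      (+-≡-cancel-≤ _ _ _ _ (sumBelow-mono _ _ K (λ i _ → g≼h i)) (g≼h K) e) j lt
... | inj₂ refl = +-≡-cancel-≤ _ _ _ _ (g≼h j) (sumBelow-mono _ _ j (λ i _ → g≼h i))
      (trans (+-comm (sumBelow g j) _) (trans e (+-comm _ (sumBelow h j))))

potential-< : ∀ {N} (x y : Vec ℕ N) → x ⊴ y → x ≢ y → potential x < potential y
potential-< {N} x y x⊴y x≢y with m≤n⇒m<n∨m≡n (sumBelow-mono _ _ (suc N) (λ i _ → ⊴⇒≼ x y x⊴y i))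
... | inj₁ lt = lt
... | inj₂ e = ⊥-elim (x≢y (rows⇒≡ x y λ i i<N →
      +-cancelˡ-≡ (sumBelow (row x) i) _ _ (trans (prefix (suc i) (s≤s i<N))
                                               (cong (_+ row y i) (sym (prefix i (≤-trans (n≤1+n _) (s≤s i<N))))))))
  where
  prefix : ∀ j → j < suc N → sumBelow (row x) j ≡ sumBelow (row y) j
  prefix = ≼-sumBelow-≡ (row x) (row y) (suc N) (⊴⇒≼ x y x⊴y) e

module _ {N : ℕ} {V c : Vec ℕ N} (unique : ∀ γ → Covers N V γ → γ ≡ c) where

  -- Climbing from β towards V, the potential strictly increases, so k bounds the length of the
  -- climb; whether V covers a given partition is not decided here, hence the double negation.
  below-unique-cover : ∀ k β → StrictlyBelow N β V → potential V ≤ potential β + k → ¬ ¬ (β ⊴ c)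
  below-unique-cover zero β (_ , β⊴V , β≢V) le _ =
    <⇒≱ (potential-< β V β⊴V β≢V) (≤-trans le (≤-reflexive (+-identityʳ _)))
  below-unique-cover (suc k) β (pβ , β⊴V , β≢V) le β⋬c = ¬¬-excluded-middle λ
    { (yes cov) → β⋬c (subst (β ⊴_) (unique β cov) (⊴-refl β))
    ; (no ¬cov) → ¬cov (pβ , β⊴V , β≢V , between) }
    where
    between : ∀ γ → IsPartition N γ → β ⊴ γ → γ ⊴ V → γ ≡ β ⊎ γ ≡ V
    between γ pγ β⊴γ γ⊴V with ≡-dec _≟_ γ β | ≡-dec _≟_ γ V
    ... | yes e | _ = inj₁ e
    ... | no _ | yes e = inj₂ e
    ... | no γ≢β | no γ≢V = ⊥-elim (below-unique-cover k γ (pγ , γ⊴V , γ≢V) le′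
                                      (λ γ⊴c → β⋬c (⊴-trans β γ c β⊴γ γ⊴c)))
      where
      le′ : potential V ≤ potential γ + k
      le′ = ≤-trans le (≤-trans (≤-reflexive (+-suc _ _))
              (+-monoˡ-≤ k (potential-< β γ β⊴γ (λ e → γ≢β (sym e)))))

¬joinIrr-of-join-below : ∀ N (V β₁ β₂ : Vec ℕ N) → JoinIrr N V → StrictlyBelow N β₁ V → StrictlyBelow N β₂ V →
  (∀ c → IsPartition N c → β₁ ⊴ c → β₂ ⊴ c → V ⊴ c) → ⊥
¬joinIrr-of-join-below N V β₁ β₂ (_ , c , (pc , c⊴V , c≢V , _) , unique) b₁ b₂ join =
  below-unique-cover unique (potential V) β₁ b₁ (m≤n+m (potential V) (potential β₁)) λ β₁⊴c →
  below-unique-cover unique (potential V) β₂ b₂ (m≤n+m (potential V) (potential β₂)) λ β₂⊴c →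
  c≢V (⊴-antisym c V c⊴V (join c pc β₁⊴c β₂⊴c))

¬joinIrr-of-disjoint-moves : ∀ N (V : Vec ℕ N) → JoinIrr N V →
  ∀ i₁ j₁ i₂ j₂ → Movable N (row V) i₁ j₁ → Movable N (row V) i₂ j₂ → suc j₁ ≤ i₂ → ⊥
¬joinIrr-of-disjoint-moves N V J i₁ j₁ i₂ j₂ mv₁ mv₂ sep =
  ¬joinIrr-of-join-below N V _ _ J (moved-below N V i₁ j₁ pV mv₁) (moved-below N V i₂ j₂ pV mv₂) join
  where
  pV : IsPartition N V
  pV = proj₁ J
  f = row V
  join : ∀ c → IsPartition N c → moved N V i₁ j₁ ⊴ c → moved N V i₂ j₂ ⊴ c → V ⊴ c
  join c pc m₁⊴c m₂⊴c = ≼⇒⊴ V c f≼c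
    where
    f≼c : f ≼ row c
    f≼c q with q ≤? i₂
    ... | yes q≤i₂ = ≤-trans (≤-reflexive (sym (trans (sumBelow-moved N V i₂ j₂ pV mv₂ q)
            (sumBelow-moveCell-before f i₂ (suc j₂) q (s≤s (proj₁ mv₂)) q≤i₂)))) (⊴⇒≼ _ c m₂⊴c q)
    ... | no q≰i₂ = ≤-trans (≤-reflexive (sym (trans (sumBelow-moved N V i₁ j₁ pV mv₁ q)
            (sumBelow-moveCell-after f i₁ (suc j₁) q (movable-source-pos mv₁) (s≤s (proj₁ mv₁))
                                     (≤-<-trans sep (≰⇒> q≰i₂)))))) (⊴⇒≼ _ c m₁⊴c q)

sumBelow-concave : ∀ g → NonIncreasing g → ∀ i →
  sumBelow g (suc (suc i)) + sumBelow g i ≤ sumBelow g (suc i) + sumBelow g (suc i)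
sumBelow-concave g ni i = ≤-trans (+-monoˡ-≤ (sumBelow g i) (+-monoʳ-≤ X (ni i)))
  (≤-reflexive (trans (+-assoc X (g i) _) (cong (X +_) (+-comm (g i) _))))
  where X = sumBelow g (suc i)

double-<⇒< : ∀ y x → y + y < x + x → y < x
double-<⇒< y x h with y <? x
... | yes p = p
... | no p = ⊥-elim (<⇒≱ h (+-mono-≤ (≮⇒≥ p) (≮⇒≥ p)))

¬joinIrr-of-chained-moves : ∀ N (V : Vec ℕ N) → JoinIrr N V →
  ∀ i₁ i₂ j₂ → Movable N (row V) i₁ i₂ → Movable N (row V) i₂ j₂ → row V i₂ ≡ suc (row V (suc i₂)) → ⊥
¬joinIrr-of-chained-moves N V J i₁ i₂ j₂ mv₁ mv₂ unit-drop =
  ¬joinIrr-of-join-below N V _ _ J (moved-below N V i₁ i₂ pV mv₁) (moved-below N V i₂ j₂ pV mv₂) join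
  where
  pV : IsPartition N V
  pV = proj₁ J
  f = row V
  join : ∀ c → IsPartition N c → moved N V i₁ i₂ ⊴ c → moved N V i₂ j₂ ⊴ c → V ⊴ c
  join c pc m₁⊴c m₂⊴c = ≼⇒⊴ V c f≼g
    where
    g = row c
    before : ∀ q → q ≤ i₂ → sumBelow f q ≤ sumBelow g q
    before q q≤i₂ = ≤-trans (≤-reflexive (sym (trans (sumBelow-moved N V i₂ j₂ pV mv₂ q)
      (sumBelow-moveCell-before f i₂ (suc j₂) q (s≤s (proj₁ mv₂)) q≤i₂)))) (⊴⇒≼ _ c m₂⊴c q)
    after : ∀ q → suc i₂ < q → sumBelow f q ≤ sumBelow g q
    after q i₂<q = ≤-trans (≤-reflexive (sym (trans (sumBelow-moved N V i₁ i₂ pV mv₁ q)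
      (sumBelow-moveCell-after f i₁ (suc i₂) q (movable-source-pos mv₁) (s≤s (proj₁ mv₁)) i₂<q))))
      (⊴⇒≼ _ c m₁⊴c q)
    -- The prefix sums of f at i₂, suc i₂, suc (suc i₂) are A, A + b + 1, A + 2b + 1, so the
    -- concavity of the prefix sums of g forces the middle inequality.
    at-suc-i₂ : sumBelow f (suc i₂) ≤ sumBelow g (suc i₂)
    at-suc-i₂ = subst (_≤ X) (sym (trans (cong (A +_) unit-drop) (+-suc A b)))
                      (double-<⇒< (A + b) X doubled)
      where
      A = sumBelow f i₂
      b = f (suc i₂)
      X = sumBelow g (suc i₂)
      f-at : sumBelow f (suc (suc i₂)) ≡ suc ((A + b) + b)
      f-at = trans (cong (λ z → A + z + b) unit-drop) (cong (_+ b) (+-suc A b))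
      rearrange : (A + b) + (A + b) ≡ ((A + b) + b) + A
      rearrange = trans (cong ((A + b) +_) (+-comm A b)) (sym (+-assoc (A + b) b A))
      doubled : suc ((A + b) + (A + b)) ≤ X + X
      doubled = ≤-trans (≤-reflexive (cong suc rearrange))
        (≤-trans (+-mono-≤ (≤-trans (≤-reflexive (sym f-at)) (after (suc (suc i₂)) ≤-refl)) (before i₂ ≤-refl))
                 (sumBelow-concave g (proj₁ pc) i₂))
    f≼g : f ≼ g
    f≼g q with q ≤? i₂
    ... | yes q≤i₂ = before q q≤i₂
    ... | no q≰i₂ with suc i₂ <? q
    ...   | yes p = after q p
    ...   | no p = subst (λ z → sumBelow f z ≤ sumBelow g z) (≤-antisym (≰⇒> q≰i₂) (≮⇒≥ p)) at-suc-i₂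

-- (a, …, a, a ∸ 1, …, a ∸ 1, 1, …, 1, 0, …) with its three blocks ending at rows e₁ ≤ e₂ ≤ e₃
shape : ℕ → ℕ → ℕ → ℕ → ℕ → ℕ
shape a e₁ e₂ e₃ x with x ≤? e₁
... | yes _ = a
... | no _ with x ≤? e₂
...   | yes _ = a ∸ 1
...   | no _ with x ≤? e₃
...     | yes _ = 1
...     | no _ = 0

module _ (a e₁ e₂ e₃ x : ℕ) where

  shape-first : x ≤ e₁ → shape a e₁ e₂ e₃ x ≡ a
  shape-first h with x ≤? e₁
  ... | yes _ = refl
  ... | no h′ = ⊥-elim (h′ h)

  shape-second : e₁ < x → x ≤ e₂ → shape a e₁ e₂ e₃ x ≡ a ∸ 1
  shape-second h h′ with x ≤? e₁
  ... | yes p = ⊥-elim (<⇒≱ h p)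
  ... | no _ with x ≤? e₂
  ...   | yes _ = refl
  ...   | no n = ⊥-elim (n h′)

  shape-third : e₁ ≤ e₂ → e₂ < x → x ≤ e₃ → shape a e₁ e₂ e₃ x ≡ 1
  shape-third e₁≤e₂ h h′ with x ≤? e₁
  ... | yes p = ⊥-elim (<⇒≱ (≤-<-trans e₁≤e₂ h) p)
  ... | no _ with x ≤? e₂
  ...   | yes p = ⊥-elim (<⇒≱ h p)
  ...   | no _ with x ≤? e₃
  ...     | yes _ = refl
  ...     | no n = ⊥-elim (n h′)

  shape-beyond : e₁ ≤ e₂ → e₂ ≤ e₃ → e₃ < x → shape a e₁ e₂ e₃ x ≡ 0
  shape-beyond e₁≤e₂ e₂≤e₃ h with x ≤? e₁
  ... | yes p = ⊥-elim (<⇒≱ (≤-<-trans (≤-trans e₁≤e₂ e₂≤e₃) h) p)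
  ... | no _ with x ≤? e₂
  ...   | yes p = ⊥-elim (<⇒≱ (≤-<-trans e₂≤e₃ h) p)
  ...   | no _ with x ≤? e₃
  ...     | yes p = ⊥-elim (<⇒≱ h p)
  ...     | no _ = refl

  shape-cases : e₁ ≤ e₂ → e₂ ≤ e₃ →
    (x ≤ e₁ × shape a e₁ e₂ e₃ x ≡ a) ⊎ (e₁ < x × x ≤ e₂ × shape a e₁ e₂ e₃ x ≡ a ∸ 1) ⊎
    (e₂ < x × x ≤ e₃ × shape a e₁ e₂ e₃ x ≡ 1) ⊎ (e₃ < x × shape a e₁ e₂ e₃ x ≡ 0)
  shape-cases e₁≤e₂ e₂≤e₃ = cases (x ≤? e₁) (x ≤? e₂) (x ≤? e₃)
    where
    cases : Dec (x ≤ e₁) → Dec (x ≤ e₂) → Dec (x ≤ e₃) →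
      (x ≤ e₁ × shape a e₁ e₂ e₃ x ≡ a) ⊎ (e₁ < x × x ≤ e₂ × shape a e₁ e₂ e₃ x ≡ a ∸ 1) ⊎
      (e₂ < x × x ≤ e₃ × shape a e₁ e₂ e₃ x ≡ 1) ⊎ (e₃ < x × shape a e₁ e₂ e₃ x ≡ 0)
    cases (yes p) _ _ = inj₁ (p , shape-first p)
    cases (no p) (yes q) _ = inj₂ (inj₁ (≰⇒> p , q , shape-second (≰⇒> p) q))
    cases (no _) (no q) (yes r) = inj₂ (inj₂ (inj₁ (≰⇒> q , r , shape-third e₁≤e₂ (≰⇒> q) r)))
    cases (no _) (no _) (no r) = inj₂ (inj₂ (inj₂ (≰⇒> r , shape-beyond e₁≤e₂ e₂≤e₃ (≰⇒> r))))

  shape-≤-head : 1 ≤ a → shape a e₁ e₂ e₃ x ≤ a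
  shape-≤-head 1≤a with x ≤? e₁
  ... | yes _ = ≤-refl
  ... | no _ with x ≤? e₂
  ...   | yes _ = m∸n≤m a 1
  ...   | no _ with x ≤? e₃
  ...     | yes _ = 1≤a
  ...     | no _ = z≤n

  shape-≥-second : x ≤ e₂ → a ∸ 1 ≤ shape a e₁ e₂ e₃ x
  shape-≥-second h with x ≤? e₁
  ... | yes _ = m∸n≤m a 1
  ... | no _ with x ≤? e₂
  ...   | yes _ = ≤-refl
  ...   | no n = ⊥-elim (n h)

  shape-≤1-after-second : e₁ ≤ e₂ → e₂ < x → shape a e₁ e₂ e₃ x ≤ 1
  shape-≤1-after-second e₁≤e₂ h with x ≤? e₁
  ... | yes p = ⊥-elim (<⇒≱ h (≤-trans p e₁≤e₂))
  ... | no _ with x ≤? e₂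
  ...   | yes p = ⊥-elim (<⇒≱ h p)
  ...   | no _ with x ≤? e₃
  ...     | yes _ = ≤-refl
  ...     | no _ = z≤n

  shape-≤1-after-first : a ≤ 2 → e₁ < x → shape a e₁ e₂ e₃ x ≤ 1
  shape-≤1-after-first a≤2 h with x ≤? e₁
  ... | yes p = ⊥-elim (<⇒≱ h p)
  ... | no _ with x ≤? e₂
  ...   | yes _ = ∸-monoˡ-≤ 1 a≤2
  ...   | no _ with x ≤? e₃
  ...     | yes _ = ≤-refl
  ...     | no _ = z≤n

shape-nonIncreasing : ∀ a e₁ e₂ e₃ → e₁ ≤ e₂ → e₂ ≤ e₃ → 1 ≤ a → (e₁ < e₂ → e₂ < e₃ → 2 ≤ a) →
  NonIncreasing (shape a e₁ e₂ e₃)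
shape-nonIncreasing a e₁ e₂ e₃ e₁≤e₂ e₂≤e₃ 1≤a 2≤a x
  with shape-cases a e₁ e₂ e₃ x e₁≤e₂ e₂≤e₃ | shape-cases a e₁ e₂ e₃ (suc x) e₁≤e₂ e₂≤e₃
... | _ | inj₂ (inj₂ (inj₂ (_ , e))) = ≤-trans (≤-reflexive e) z≤n
... | inj₁ (_ , e) | inj₁ (_ , e′) = ≤-reflexive (trans e′ (sym e))
... | inj₁ (_ , e) | inj₂ (inj₁ (_ , _ , e′)) = subst₂ _≤_ (sym e′) (sym e) (m∸n≤m a 1)
... | inj₁ (_ , e) | inj₂ (inj₂ (inj₁ (_ , _ , e′))) = subst₂ _≤_ (sym e′) (sym e) 1≤a
... | inj₂ (inj₁ (p , _ , _)) | inj₁ (q , _) = ⊥-elim (<⇒≱ p (≤-trans (n≤1+n x) q))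
... | inj₂ (inj₁ (_ , _ , e)) | inj₂ (inj₁ (_ , _ , e′)) = ≤-reflexive (trans e′ (sym e))
... | inj₂ (inj₁ (p , q , e)) | inj₂ (inj₂ (inj₁ (p′ , q′ , e′))) =
  subst₂ _≤_ (sym e′) (sym e) (∸-monoˡ-≤ 1 (2≤a (<-≤-trans p q) (<-≤-trans p′ q′)))
... | inj₂ (inj₂ (inj₁ (p , _ , _))) | inj₁ (q , _) = ⊥-elim (<⇒≱ (≤-<-trans e₁≤e₂ p) (≤-trans (n≤1+n x) q))
... | inj₂ (inj₂ (inj₁ (p , _ , _))) | inj₂ (inj₁ (_ , q , _)) = ⊥-elim (<⇒≱ p (≤-trans (n≤1+n x) q))
... | inj₂ (inj₂ (inj₁ (_ , _ , e))) | inj₂ (inj₂ (inj₁ (_ , _ , e′))) = ≤-reflexive (trans e′ (sym e))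
... | inj₂ (inj₂ (inj₂ (p , _))) | inj₁ (q , _) =
  ⊥-elim (<⇒≱ (≤-<-trans (≤-trans e₁≤e₂ e₂≤e₃) p) (≤-trans (n≤1+n x) q))
... | inj₂ (inj₂ (inj₂ (p , _))) | inj₂ (inj₁ (_ , q , _)) = ⊥-elim (<⇒≱ (≤-<-trans e₂≤e₃ p) (≤-trans (n≤1+n x) q))
... | inj₂ (inj₂ (inj₂ (p , _))) | inj₂ (inj₂ (inj₁ (_ , q , _))) = ⊥-elim (<⇒≱ p (≤-trans (n≤1+n x) q))

-- The four families of join-irreducible partitions:
-- a^p (a ≥ 2), a^p 1^r (a ≥ 3), a^p (a-1)^q (a ≥ 2) and a^p (a-1)^q 1^r (a ≥ 4).
ShapeFamily : ℕ → ℕ → ℕ → ℕ → Set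
ShapeFamily a e₁ e₂ e₃ =
  (e₂ ≡ e₁ × e₃ ≡ e₁) ⊎ (e₂ ≡ e₁ × e₁ < e₃ × 3 ≤ a) ⊎ (e₁ < e₂ × e₃ ≡ e₂) ⊎ (e₁ < e₂ × e₂ < e₃ × 4 ≤ a)

ShapeCond : ℕ → ℕ → ℕ → ℕ → Set
ShapeCond a e₁ e₂ e₃ = e₁ ≤ e₂ × e₂ ≤ e₃ × 2 ≤ a × ShapeFamily a e₁ e₂ e₃

JoinIrrShape : (N : ℕ) → Vec ℕ N → Set
JoinIrrShape N V = Σ ℕ λ a → Σ ℕ λ e₁ → Σ ℕ λ e₂ → Σ ℕ λ e₃ →
  ShapeCond a e₁ e₂ e₃ × (∀ x → row V x ≡ shape a e₁ e₂ e₃ x)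

shape-pos : ∀ a e₁ e₂ e₃ → e₁ ≤ e₂ → e₂ ≤ e₃ → 2 ≤ a → 1 ≤ shape a e₁ e₂ e₃ e₃
shape-pos a e₁ e₂ e₃ e₁≤e₂ e₂≤e₃ 2≤a with shape-cases a e₁ e₂ e₃ e₃ e₁≤e₂ e₂≤e₃
... | inj₁ (_ , e) = subst (1 ≤_) (sym e) (≤-trans (s≤s z≤n) 2≤a)
... | inj₂ (inj₁ (_ , _ , e)) = subst (1 ≤_) (sym e) (∸-monoˡ-≤ 1 2≤a)
... | inj₂ (inj₂ (inj₁ (_ , _ , e))) = ≤-reflexive (sym e)
... | inj₂ (inj₂ (inj₂ (lt , _))) = ⊥-elim (<-irrefl refl lt)

sumBelow-≥-length : ∀ f k → (∀ y → y < k → 1 ≤ f y) → k ≤ sumBelow f k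
sumBelow-≥-length f zero h = z≤n
sumBelow-≥-length f (suc k) h = subst (_≤ sumBelow f k + f k) (+-comm k 1)
  (+-mono-≤ (sumBelow-≥-length f k (λ y lt → h y (m≤n⇒m≤1+n lt))) (h k ≤-refl))

positive-row-not-last : ∀ N f → IsPartitionᶠ N f → 2 ≤ f 0 → ∀ x → 1 ≤ f x → suc x < N
positive-row-not-last N f (ni , s , hz) 2≤f0 x 1≤fx with suc x <? N
... | yes p = p
... | no p = ⊥-elim (<-irrefl (sym s) (sum-exceeds N refl))
  where
  x<N : x < N
  x<N with x <? N
  ... | yes q = q
  ... | no q = ⊥-elim (<-irrefl (sym (hz x (≮⇒≥ q))) 1≤fx)
  all-positive : ∀ y → y < N → 1 ≤ f y
  all-positive y y<N = ≤-trans 1≤fx (nonIncreasing-≤ f ni y x (≤-pred (≤-trans y<N (≮⇒≥ p))))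
  sum-exceeds : ∀ M → M ≡ N → N < sumBelow f N
  sum-exceeds zero e = ⊥-elim (<⇒≱ (subst (x <_) (sym e) x<N) z≤n)
  sum-exceeds (suc M) refl = subst (suc M <_) (sym (sumBelow-suc f M))
    (+-mono-≤ 2≤f0 (sumBelow-≥-length (λ i → f (suc i)) M (λ y lt → all-positive (suc y) (s≤s lt))))

module _ (N : ℕ) (V : Vec ℕ N) (pV : IsPartition N V) (a e₁ e₂ e₃ : ℕ)
         (cond : ShapeCond a e₁ e₂ e₃) (rows : ∀ x → row V x ≡ shape a e₁ e₂ e₃ x) where

  private
    f = row V
    e₁≤e₂ : e₁ ≤ e₂
    e₁≤e₂ = proj₁ cond
    2≤a : 2 ≤ a
    2≤a = proj₁ (proj₂ (proj₂ cond))

    not-last : ∀ x → 1 ≤ f x → suc x < N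
    not-last = positive-row-not-last N f (row-isPartitionᶠ V pV)
      (subst (2 ≤_) (sym (trans (rows 0) (shape-first a e₁ e₂ e₃ 0 z≤n))) 2≤a)

    flat-split : ∀ lo q → lo < q → q ≤ suc e₂ → (∀ x → lo < x → shape a e₁ e₂ e₃ x ≤ 1) →
      Flat f 0 q × Flat f q N
    flat-split lo q lo<q q≤e₂ small =
      (λ x y _ _ x<q y<q → subst₂ (λ u w → u ≤ suc w) (sym (rows x)) (sym (rows y))
         (≤-trans (shape-≤-head a e₁ e₂ e₃ x (≤-trans (s≤s z≤n) 2≤a))
           (≤-trans (m≤n+m∸n a 1) (s≤s (shape-≥-second a e₁ e₂ e₃ y (≤-pred (≤-trans y<q q≤e₂))))))) ,
      (λ x y q≤x _ _ _ → subst (_≤ suc (f y)) (sym (rows x))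
         (≤-trans (small x (<-≤-trans lo<q q≤x)) (s≤s z≤n)))

    cliff : ∀ s t → f (suc e₂) ≡ s → f e₂ ≡ t → 2 + s ≤ t → JoinIrr N V
    cliff s t fs ft gap = joinIrr-of-movable N V e₂ e₂ pV
      (≤-refl , not-last e₂ (≤-trans (s≤s z≤n) gap′) , drop , drop , gap′)
      (λ q lo hi → flat-split e₂ q lo hi (λ x → shape-≤1-after-second a e₁ e₂ e₃ x e₁≤e₂))
      where
      gap′ : 2 + f (suc e₂) ≤ f e₂
      gap′ = subst₂ (λ u w → 2 + u ≤ w) (sym fs) (sym ft) gap
      drop : f (suc e₂) < f e₂
      drop = ≤-trans (s≤s (n≤1+n _)) gap′

    f-e₂-first : e₂ ≡ e₁ → f e₂ ≡ a
    f-e₂-first e = trans (rows e₂) (shape-first a e₁ e₂ e₃ e₂ (≤-reflexive e))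
    f-e₂-second : e₁ < e₂ → f e₂ ≡ a ∸ 1
    f-e₂-second lt = trans (rows e₂) (shape-second a e₁ e₂ e₃ e₂ lt ≤-refl)
    f-after-e₂-zero : e₃ ≡ e₂ → f (suc e₂) ≡ 0
    f-after-e₂-zero e = trans (rows (suc e₂))
      (shape-beyond a e₁ e₂ e₃ (suc e₂) e₁≤e₂ (proj₁ (proj₂ cond)) (s≤s (≤-reflexive e)))
    f-after-e₂-one : e₂ < e₃ → f (suc e₂) ≡ 1
    f-after-e₂-one lt = trans (rows (suc e₂)) (shape-third a e₁ e₂ e₃ (suc e₂) e₁≤e₂ ≤-refl lt)

    -- For a = 2 there is no cliff: the shape 2^p 1^q moves a cell from row e₁ to row suc e₂.
    twos-then-ones : e₁ < e₂ → e₃ ≡ e₂ → a ≡ 2 → JoinIrr N V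
    twos-then-ones lt e a≡2 = joinIrr-of-movable N V e₁ e₂ pV
      (e₁≤e₂ , not-last e₂ (≤-reflexive (sym f-e₂)) , drop₁ , drop₂ , ≤-reflexive (sym f-e₁))
      (λ q lo hi → flat-split e₁ q lo hi (λ x → shape-≤1-after-first a e₁ e₂ e₃ x (≤-reflexive a≡2)))
      where
      f-e₁ : f e₁ ≡ 2 + f (suc e₂)
      f-e₁ = trans (rows e₁) (trans (shape-first a e₁ e₂ e₃ e₁ ≤-refl)
                                  (trans a≡2 (cong (2 +_) (sym (f-after-e₂-zero e)))))
      f-e₂ : f e₂ ≡ 1
      f-e₂ = trans (f-e₂-second lt) (cong (_∸ 1) a≡2)
      drop₁ : f (suc e₁) < f e₁
      drop₁ = subst₂ _<_
        (sym (trans (rows (suc e₁)) (trans (shape-second a e₁ e₂ e₃ (suc e₁) ≤-refl lt) (cong (_∸ 1) a≡2))))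
                         (sym (trans (rows e₁) (trans (shape-first a e₁ e₂ e₃ e₁ ≤-refl) a≡2))) ≤-refl
      drop₂ : f (suc e₂) < f e₂
      drop₂ = subst₂ _<_ (sym (f-after-e₂-zero e)) (sym f-e₂) ≤-refl

  shape⇒joinIrr : JoinIrr N V
  shape⇒joinIrr with proj₂ (proj₂ (proj₂ cond))
  ... | inj₁ (e₂≡e₁ , e₃≡e₁) = cliff 0 a (f-after-e₂-zero (trans e₃≡e₁ (sym e₂≡e₁))) (f-e₂-first e₂≡e₁) 2≤a
  ... | inj₂ (inj₁ (e₂≡e₁ , lt , 3≤a)) =
    cliff 1 a (f-after-e₂-one (subst (_< e₃) (sym e₂≡e₁) lt)) (f-e₂-first e₂≡e₁) 3≤a
  ... | inj₂ (inj₂ (inj₁ (lt , e₃≡e₂))) with 3 ≤? a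
  ...   | yes 3≤a = cliff 0 (a ∸ 1) (f-after-e₂-zero e₃≡e₂) (f-e₂-second lt) (∸-monoˡ-≤ 1 3≤a)
  ...   | no 3≰a = twos-then-ones lt e₃≡e₂ (≤-antisym (≤-pred (≰⇒> 3≰a)) 2≤a)
  shape⇒joinIrr | inj₂ (inj₂ (inj₂ (lt , lt′ , 4≤a))) =
    cliff 1 (a ∸ 1) (f-after-e₂-one lt′) (f-e₂-second lt) (∸-monoˡ-≤ 1 4≤a)

nonIncreasing-zero : ∀ f → NonIncreasing f → ∀ e → f (suc e) ≡ 0 → ∀ x → e < x → f x ≡ 0
nonIncreasing-zero f ni e fe≡0 x e<x = n≤0⇒n≡0 (≤-trans (nonIncreasing-≤ f ni (suc e) x e<x) (≤-reflexive fe≡0))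

record Block (f : ℕ → ℕ) (start : ℕ) : Set where
  field
    end : ℕ
    start≤end : start ≤ end
    constant : ∀ x → start ≤ x → x ≤ end → f x ≡ f start
    drop : f (suc end) < f end

  value-end : f end ≡ f start
  value-end = constant end start≤end ≤-refl

open Block

block : ∀ N f → NonIncreasing f → (∀ i → N ≤ i → f i ≡ 0) → ∀ i → 1 ≤ f i → Block f i
block N f ni hz i fi = go N i (m≤n+m N i) fi
  where
  go : ∀ k i → N ≤ i + k → 1 ≤ f i → Block f i
  go zero i le fi = ⊥-elim (<-irrefl (sym (hz i (≤-trans le (≤-reflexive (+-identityʳ i))))) fi)
  go (suc k) i le fi with f (suc i) <? f i
  ... | yes lt = record { end = i ; start≤end = ≤-refl
                        ; constant = λ x i≤x x≤i → cong f (≤-antisym x≤i i≤x) ; drop = lt }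
  ... | no nlt = record { end = end B ; start≤end = ≤-trans (n≤1+n i) (start≤end B)
                        ; constant = constant′ ; drop = drop B }
    where
    same : f (suc i) ≡ f i
    same = ≤-antisym (ni i) (≮⇒≥ nlt)
    B : Block f (suc i)
    B = go k (suc i) (≤-trans le (≤-reflexive (+-suc i k))) (subst (1 ≤_) (sym same) fi)
    constant′ : ∀ x → i ≤ x → x ≤ end B → f x ≡ f i
    constant′ x i≤x x≤e with m≤n⇒m<n∨m≡n i≤x
    ... | inj₂ refl = refl
    ... | inj₁ lt = trans (constant B x lt x≤e) same

rows-shape : ∀ (f : ℕ → ℕ) a e₁ e₂ e₃ → e₁ ≤ e₂ → e₂ ≤ e₃ →
  (∀ x → x ≤ e₁ → f x ≡ a) → (∀ x → e₁ < x → x ≤ e₂ → f x ≡ a ∸ 1) →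
  (∀ x → e₂ < x → x ≤ e₃ → f x ≡ 1) → (∀ x → e₃ < x → f x ≡ 0) →
  ∀ x → f x ≡ shape a e₁ e₂ e₃ x
rows-shape f a e₁ e₂ e₃ e₁≤e₂ e₂≤e₃ first second third beyond x with shape-cases a e₁ e₂ e₃ x e₁≤e₂ e₂≤e₃
... | inj₁ (p , e) = trans (first x p) (sym e)
... | inj₂ (inj₁ (p , q , e)) = trans (second x p q) (sym e)
... | inj₂ (inj₂ (inj₁ (p , q , e))) = trans (third x p q) (sym e)
... | inj₂ (inj₂ (inj₂ (p , e))) = trans (beyond x p) (sym e)

¬joinIrr-of-rows≤1 : ∀ N (V : Vec ℕ N) → JoinIrr N V → row V 0 ≤ 1 → ⊥
¬joinIrr-of-rows≤1 N V (pV , c , (pc , c⊴V , c≢V , _) , _) head≤1 = c≢V (rows⇒≡ c V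
  (flat-blocks-rigid N N (row c) (row V) (proj₁ pc′) (⊴⇒≼ c V c⊴V) sums sums ≤-refl
    (λ x _ _ _ _ _ → ≤-trans (nonIncreasing-≤ (row V) (proj₁ pV) 0 x z≤n) (≤-trans head≤1 (s≤s z≤n)))
    (λ x _ N≤x _ x<N _ → ⊥-elim (<⇒≱ x<N N≤x))))
  where
  pc′ : IsPartitionᶠ N (row c)
  pc′ = row-isPartitionᶠ c pc
  sums : sumBelow (row c) N ≡ sumBelow (row V) N
  sums = trans (proj₁ (proj₂ pc′)) (sym (proj₁ (proj₂ (row-isPartitionᶠ V pV))))

-- Peeling off the blocks of rows of equal length: a join-irreducible partition has at most
-- three blocks, and every other arrangement admits two independent cell moves.
module Classification (N : ℕ) (V : Vec ℕ N) (J : JoinIrr N V) where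

  private
    f = row V
    pf : IsPartitionᶠ N f
    pf = row-isPartitionᶠ V (proj₁ J)
    ni : NonIncreasing f
    ni = proj₁ pf

    2≤a : 2 ≤ f 0
    2≤a with 2 ≤? f 0
    ... | yes p = p
    ... | no p = ⊥-elim (¬joinIrr-of-rows≤1 N V J (≤-pred (≰⇒> p)))

    a = f 0

    block′ : ∀ i → 1 ≤ f i → Block f i
    block′ = block N f ni (proj₂ (proj₂ pf))

    movable : ∀ i j → i ≤ j → f (suc i) < f i → f (suc j) < f j → 2 + f (suc j) ≤ f i → Movable N f i j
    movable i j i≤j dᵢ dⱼ gap = i≤j , positive-row-not-last N f pf 2≤a j (≤-trans (s≤s z≤n) dⱼ) , dᵢ , dⱼ , gap

    disjoint : ∀ i₁ j₁ i₂ j₂ → Movable N f i₁ j₁ → Movable N f i₂ j₂ → suc j₁ ≤ i₂ → ⊥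
    disjoint = ¬joinIrr-of-disjoint-moves N V J

    gap-of-≢ : ∀ {s t} → s < t → t ≢ suc s → 2 + s ≤ t
    gap-of-≢ s<t t≢1+s = ≤∧≢⇒< s<t (λ e → t≢1+s (sym e))

    B₁ : Block f 0
    B₁ = block′ 0 (≤-trans (s≤s z≤n) 2≤a)
    e₁ = end B₁
    first : ∀ x → x ≤ e₁ → f x ≡ a
    first x = constant B₁ x z≤n
    drop₁ : f (suc e₁) < f e₁
    drop₁ = drop B₁

  one-block : f (suc e₁) ≡ 0 → JoinIrrShape N V
  one-block b≡0 = a , e₁ , e₁ , e₁ , (≤-refl , ≤-refl , 2≤a , inj₁ (refl , refl)) ,
    rows-shape f a e₁ e₁ e₁ ≤-refl ≤-refl first (λ x p q → ⊥-elim (<⇒≱ p q)) (λ x p q → ⊥-elim (<⇒≱ p q))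
      (nonIncreasing-zero f ni e₁ b≡0)

  module _ (B₂ : Block f (suc e₁)) where

    private
      b = f (suc e₁)
      e₂ = end B₂
      e₁<e₂ : e₁ < e₂
      e₁<e₂ = start≤end B₂
      e₁≤e₂ : e₁ ≤ e₂
      e₁≤e₂ = ≤-trans (n≤1+n e₁) e₁<e₂
      second : ∀ x → e₁ < x → x ≤ e₂ → f x ≡ b
      second = constant B₂
      b<a : b < a
      b<a = subst (b <_) (value-end B₁) drop₁
      drop₂ : f (suc e₂) < f e₂
      drop₂ = drop B₂
      1≤b : 1 ≤ b
      1≤b = subst (1 ≤_) (value-end B₂) (≤-<-trans z≤n drop₂)

    two-blocks : f (suc e₂) ≡ 0 → JoinIrrShape N V
    two-blocks c≡0 with a ≟ suc b
    ... | yes a≡1+b = a , e₁ , e₂ , e₂ , (e₁≤e₂ , ≤-refl , 2≤a , inj₂ (inj₂ (inj₁ (e₁<e₂ , refl)))) ,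
      rows-shape f a e₁ e₂ e₂ e₁≤e₂ ≤-refl first (λ x p q → trans (second x p q) (cong (_∸ 1) (sym a≡1+b)))
        (λ x p q → ⊥-elim (<⇒≱ p q)) (nonIncreasing-zero f ni e₂ c≡0)
    ... | no a≢1+b with b ≟ 1
    ...   | yes b≡1 = a , e₁ , e₁ , e₂ , (≤-refl , e₁≤e₂ , 2≤a , inj₂ (inj₁ (refl , e₁<e₂ , 3≤a))) ,
      rows-shape f a e₁ e₁ e₂ ≤-refl e₁≤e₂ first (λ x p q → ⊥-elim (<⇒≱ p q)) (λ x p q → trans (second x p q) b≡1)
        (nonIncreasing-zero f ni e₂ c≡0)
      where
      3≤a : 3 ≤ a
      3≤a = subst (λ z → 2 + z ≤ a) b≡1 (gap-of-≢ b<a a≢1+b)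
    ...   | no b≢1 = ⊥-elim (disjoint e₁ e₁ e₂ e₂
      (movable e₁ e₁ ≤-refl drop₁ drop₁ (subst (2 + b ≤_) (sym (value-end B₁)) (gap-of-≢ b<a a≢1+b)))
      (movable e₂ e₂ ≤-refl drop₂ drop₂ (subst₂ (λ u w → 2 + u ≤ w) (sym c≡0) (sym (value-end B₂))
        (gap-of-≢ 1≤b b≢1)))
      e₁<e₂)

    module _ (B₃ : Block f (suc e₂)) where

      private
        c = f (suc e₂)
        e₃ = end B₃
        e₂<e₃ : e₂ < e₃
        e₂<e₃ = start≤end B₃
        e₂≤e₃ : e₂ ≤ e₃
        e₂≤e₃ = ≤-trans (n≤1+n e₂) e₂<e₃
        drop₃ : f (suc e₃) < f e₃
        drop₃ = drop B₃
        c<b : c < b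
        c<b = subst (c <_) (value-end B₂) drop₂
        1≤c : 1 ≤ c
        1≤c = subst (1 ≤_) (value-end B₃) (≤-<-trans z≤n drop₃)
        gap₁₂ : 2 + f (suc e₂) ≤ f e₁
        gap₁₂ = subst (2 + c ≤_) (sym (value-end B₁)) (<-≤-trans (s≤s c<b) b<a)

      three-blocks : f (suc e₃) ≡ 0 → JoinIrrShape N V
      three-blocks d≡0 with a ≟ suc b | c ≟ 1
      ... | no a≢1+b | _ = ⊥-elim (disjoint e₁ e₁ e₂ e₃
        (movable e₁ e₁ ≤-refl drop₁ drop₁ (subst (2 + b ≤_) (sym (value-end B₁)) (gap-of-≢ b<a a≢1+b)))
        (movable e₂ e₃ e₂≤e₃ drop₂ drop₃ gap₂₃) e₁<e₂)
        where
        gap₂₃ : 2 + f (suc e₃) ≤ f e₂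
        gap₂₃ = subst₂ (λ u w → 2 + u ≤ w) (sym d≡0) (sym (value-end B₂)) (<-≤-trans (s≤s 1≤c) c<b)
      ... | yes a≡1+b | no c≢1 = ⊥-elim (disjoint e₁ e₂ e₃ e₃
        (movable e₁ e₂ e₁≤e₂ drop₁ drop₂ gap₁₂)
        (movable e₃ e₃ ≤-refl drop₃ drop₃ (subst₂ (λ u w → 2 + u ≤ w) (sym d≡0) (sym (value-end B₃))
          (gap-of-≢ 1≤c c≢1)))
        e₂<e₃)
      ... | yes a≡1+b | yes c≡1 with 3 ≤? b
      ...   | yes 3≤b = a , e₁ , e₂ , e₃ ,
        (e₁≤e₂ , e₂≤e₃ , 2≤a , inj₂ (inj₂ (inj₂ (e₁<e₂ , e₂<e₃ , subst (4 ≤_) (sym a≡1+b) (s≤s 3≤b))))) ,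
        rows-shape f a e₁ e₂ e₃ e₁≤e₂ e₂≤e₃ first
          (λ x p q → trans (second x p q) (cong (_∸ 1) (sym a≡1+b)))
          (λ x p q → trans (constant B₃ x p q) c≡1) (nonIncreasing-zero f ni e₃ d≡0)
      ...   | no 3≰b = ⊥-elim (¬joinIrr-of-chained-moves N V J e₁ e₂ e₃
        (movable e₁ e₂ e₁≤e₂ drop₁ drop₂ gap₁₂) (movable e₂ e₃ e₂≤e₃ drop₂ drop₃ gap₂₃) unit-drop)
        where
        b≡2 : b ≡ 2
        b≡2 = ≤-antisym (≤-pred (≰⇒> 3≰b)) (<-≤-trans (s≤s 1≤c) c<b)
        gap₂₃ : 2 + f (suc e₃) ≤ f e₂
        gap₂₃ = subst₂ (λ u w → 2 + u ≤ w) (sym d≡0) (sym (trans (value-end B₂) b≡2)) ≤-refl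
        unit-drop : f e₂ ≡ suc (f (suc e₂))
        unit-drop = trans (value-end B₂) (trans b≡2 (cong suc (sym c≡1)))

      four-blocks : Block f (suc e₃) → ⊥
      four-blocks B₄ = disjoint e₁ e₂ e₃ (end B₄) (movable e₁ e₂ e₁≤e₂ drop₁ drop₂ gap₁₂)
        (movable e₃ (end B₄) (≤-trans (n≤1+n e₃) (start≤end B₄)) drop₃ (drop B₄)
          (≤-trans (s≤s (subst (f (suc (end B₄)) <_) (value-end B₄) (drop B₄))) drop₃))
        e₂<e₃

  joinIrr⇒shape : JoinIrrShape N V
  joinIrr⇒shape with f (suc e₁) ≟ 0
  ... | yes b≡0 = one-block b≡0
  ... | no b≢0 = after-first (block′ (suc e₁) (n≢0⇒n>0 b≢0))
    where
    after-second : ∀ B₂ → Block f (suc (end B₂)) → JoinIrrShape N V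
    after-second B₂ B₃ with f (suc (end B₃)) ≟ 0
    ... | yes d≡0 = three-blocks B₂ B₃ d≡0
    ... | no d≢0 = ⊥-elim (four-blocks B₂ B₃ (block′ _ (n≢0⇒n>0 d≢0)))
    after-first : Block f (suc e₁) → JoinIrrShape N V
    after-first B₂ with f (suc (end B₂)) ≟ 0
    ... | yes c≡0 = two-blocks B₂ c≡0
    ... | no c≢0 = after-second B₂ (block′ _ (n≢0⇒n>0 c≢0))

row-decAt : ∀ {k} (v : Vec ℕ k) i x → row (decAt v (suc i)) x ≡ row v x ∸ δ i x
row-decAt [] i x = sym (0∸n≡0 (δ i x))
row-decAt (y ∷ v) zero zero = refl
row-decAt (y ∷ v) zero (suc x) = refl
row-decAt (y ∷ v) (suc i) zero = refl
row-decAt (y ∷ v) (suc i) (suc x) = row-decAt v i x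

row-incAt : ∀ {k} (v : Vec ℕ k) i x → i < k → row (incAt v (suc i)) x ≡ row v x + δ i x
row-incAt (y ∷ v) zero zero _ = +-comm 1 y
row-incAt (y ∷ v) zero (suc x) _ = sym (+-identityʳ _)
row-incAt (y ∷ v) (suc i) zero _ = sym (+-identityʳ y)
row-incAt (y ∷ v) (suc i) (suc x) (s≤s lt) = row-incAt v i x lt

row-∷ʳ : ∀ {k} (v : Vec ℕ k) y x → row (v ∷ʳ y) x ≡ row v x + δ k x * y
row-∷ʳ [] y zero = sym (+-identityʳ y)
row-∷ʳ [] y (suc x) = refl
row-∷ʳ (z ∷ v) y zero = sym (+-identityʳ z)
row-∷ʳ (z ∷ v) y (suc x) = row-∷ʳ v y x

row-down : ∀ {n} (v : Vec ℕ n) i → i ≤ n → ∀ x → row (down v (suc i)) x ≡ row v x + δ i x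
row-down {n} v i i≤n x with suc i ≤? n | m≤n⇒m<n∨m≡n i≤n
... | yes _ | inj₁ i<n = trans (row-∷ʳ (incAt v (suc i)) 0 x)
  (trans (cong (row (incAt v (suc i)) x +_) (*-zeroʳ (δ n x))) (trans (+-identityʳ _) (row-incAt v i x i<n)))
... | yes i<n | inj₂ refl = ⊥-elim (<-irrefl refl i<n)
... | no i≮n | inj₁ i<n = ⊥-elim (i≮n i<n)
... | no _ | inj₂ refl = trans (row-∷ʳ v 1 x) (cong (row v x +_) (*-identityʳ (δ i x)))

removeCell : (ℕ → ℕ) → ℕ → ℕ → ℕ
removeCell g r x = g x ∸ δ r x

sumBelow-removeCell : ∀ g r q → r < q → 1 ≤ g r → suc (sumBelow (removeCell g r) q) ≡ sumBelow g q
sumBelow-removeCell g r (suc q) (s≤s r≤q) 1≤gr with m≤n⇒m<n∨m≡n r≤q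
... | inj₂ refl = begin
    suc (sumBelow (removeCell g r) r + (g r ∸ δ r r))
      ≡⟨ cong₂ (λ s t → suc (s + (g r ∸ t)))
           (sumBelow-cong _ g r (λ x x<r → cong (g x ∸_) (δ-≢ r x (>⇒≢ x<r)))) (δ-refl r) ⟩
    suc (sumBelow g r + (g r ∸ 1)) ≡⟨ sym (+-suc (sumBelow g r) _) ⟩
    sumBelow g r + suc (g r ∸ 1)   ≡⟨ cong (sumBelow g r +_) (trans (+-comm 1 _) (m∸n+n≡m 1≤gr)) ⟩
    sumBelow g r + g r ∎
  where open ≡-Reasoning
... | inj₁ r<q = cong₂ _+_ (sumBelow-removeCell g r q r<q 1≤gr) (cong (g q ∸_) (δ-≢ r q (<⇒≢ r<q)))

removeCell-+δ : ∀ g r x → 1 ≤ g r → removeCell g r x + δ r x ≡ g x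
removeCell-+δ g r x 1≤gr with r ≟ x
... | yes refl rewrite δ-refl r = m∸n+n≡m 1≤gr
... | no r≢x rewrite δ-≢ r x r≢x = +-identityʳ (g x)

shape-isPartition : ∀ N (V : Vec ℕ N) a e₁ e₂ e₃ → ShapeCond a e₁ e₂ e₃ →
  (∀ x → row V x ≡ shape a e₁ e₂ e₃ x) → sumBelow (row V) N ≡ N → IsPartition N V
shape-isPartition N V a e₁ e₂ e₃ (e₁≤e₂ , e₂≤e₃ , 2≤a , _) rows s =
  (λ x → subst₂ _≤_ (sym (rows (suc x))) (sym (rows x))
     (shape-nonIncreasing a e₁ e₂ e₃ e₁≤e₂ e₂≤e₃ (≤-trans (s≤s z≤n) 2≤a) (λ _ _ → 2≤a) x)) ,
  trans (sum≡sumBelow V) s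

removeCell-joinIrr : ∀ n (γ : Vec ℕ (suc n)) → IsPartition (suc n) γ → row γ n ≡ 0 →
  ∀ r → r < n → 1 ≤ row γ r → ∀ a e₁ e₂ e₃ → ShapeCond a e₁ e₂ e₃ →
  (∀ x → removeCell (row γ) r x ≡ shape a e₁ e₂ e₃ x) →
  Σ (Vec ℕ n) λ α → JoinIrr n α × (∀ x → row α x ≡ shape a e₁ e₂ e₃ x) × γ ≡ down α (suc r)
removeCell-joinIrr n γ pγ gn≡0 r r<n 1≤gr a e₁ e₂ e₃ cond rows = α , Jα , rows-α , γ≡down
  where
  g = row γ
  pg : IsPartitionᶠ (suc n) g
  pg = row-isPartitionᶠ γ pγ
  removed-zero : ∀ x → n ≤ x → removeCell g r x ≡ 0
  removed-zero x n≤x = trans (cong (_∸ δ r x) (n≤0⇒n≡0 (≤-trans (nonIncreasing-≤ g (proj₁ pg) n x n≤x)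
                                                          (≤-reflexive gn≡0)))) (0∸n≡0 (δ r x))
  α : Vec ℕ n
  α = fromFun n (removeCell g r)
  rows-removed : ∀ x → row α x ≡ removeCell g r x
  rows-removed = row-fromFun n _ removed-zero
  rows-α : ∀ x → row α x ≡ shape a e₁ e₂ e₃ x
  rows-α x = trans (rows-removed x) (rows x)
  sum-g : sumBelow g n ≡ suc n
  sum-g = trans (sym (+-identityʳ _)) (trans (cong (sumBelow g n +_) (sym gn≡0)) (proj₁ (proj₂ pg)))
  sum-α : sumBelow (row α) n ≡ n
  sum-α = trans (sumBelow-cong _ _ n (λ x _ → rows-removed x))
                (suc-injective (trans (sumBelow-removeCell g r n r<n 1≤gr) sum-g))
  Jα : JoinIrr n α
  Jα = shape⇒joinIrr n α (shape-isPartition n α a e₁ e₂ e₃ cond rows-α sum-α) a e₁ e₂ e₃ cond rows-α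
  γ≡down : γ ≡ down α (suc r)
  γ≡down = rows⇒≡ γ (down α (suc r)) λ x _ → sym (trans (row-down α r (<⇒≤ r<n) x)
             (trans (cong (_+ δ r x) (rows-removed x)) (removeCell-+δ g r x 1≤gr)))

shape-removeCell-head : ∀ a e₂ e₃ → e₂ ≤ e₃ → ∀ x →
  removeCell (shape a 0 e₂ e₃) 0 x ≡ shape (a ∸ 1) e₂ e₂ e₃ x
shape-removeCell-head a e₂ e₃ e₂≤e₃ zero =
  trans (cong (_∸ 1) (shape-first a 0 e₂ e₃ 0 z≤n)) (sym (shape-first (a ∸ 1) e₂ e₂ e₃ 0 z≤n))
shape-removeCell-head a e₂ e₃ e₂≤e₃ (suc x) with shape-cases a 0 e₂ e₃ (suc x) z≤n e₂≤e₃
... | inj₁ (() , _)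
... | inj₂ (inj₁ (_ , le , e)) = trans e (sym (shape-first (a ∸ 1) e₂ e₂ e₃ (suc x) le))
... | inj₂ (inj₂ (inj₁ (lt , le , e))) = trans e (sym (shape-third (a ∸ 1) e₂ e₂ e₃ (suc x) ≤-refl lt le))
... | inj₂ (inj₂ (inj₂ (lt , e))) = trans e (sym (shape-beyond (a ∸ 1) e₂ e₂ e₃ (suc x) ≤-refl e₂≤e₃ lt))

shape-removeCell-end : ∀ a e₁ e₂ e₃ → suc e₁ ≤ e₂ → e₂ ≤ e₃ → ∀ x →
  removeCell (shape a (suc e₁) e₂ e₃) (suc e₁) x ≡ shape a e₁ e₂ e₃ x
shape-removeCell-end a e₁ e₂ e₃ e₁<e₂ e₂≤e₃ x with shape-cases a (suc e₁) e₂ e₃ x e₁<e₂ e₂≤e₃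
... | inj₁ (le , e) with x ≟ suc e₁
...   | yes refl rewrite δ-refl (suc e₁) = trans (cong (_∸ 1) e) (sym (shape-second a e₁ e₂ e₃ (suc e₁) ≤-refl e₁<e₂))
...   | no ne rewrite δ-≢ (suc e₁) x (λ q → ne (sym q)) =
  trans e (sym (shape-first a e₁ e₂ e₃ x (≤-pred (≤∧≢⇒< le ne))))
shape-removeCell-end a e₁ e₂ e₃ e₁<e₂ e₂≤e₃ x | inj₂ (inj₁ (lt , le , e))
  rewrite δ-≢ (suc e₁) x (<⇒≢ lt) = trans e (sym (shape-second a e₁ e₂ e₃ x (≤-trans (n≤1+n _) lt) le))
shape-removeCell-end a e₁ e₂ e₃ e₁<e₂ e₂≤e₃ x | inj₂ (inj₂ (inj₁ (lt , le , e)))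
  rewrite δ-≢ (suc e₁) x (<⇒≢ (≤-<-trans e₁<e₂ lt)) =
    trans e (sym (shape-third a e₁ e₂ e₃ x (≤-trans (n≤1+n _) e₁<e₂) lt le))
shape-removeCell-end a e₁ e₂ e₃ e₁<e₂ e₂≤e₃ x | inj₂ (inj₂ (inj₂ (lt , e)))
  rewrite δ-≢ (suc e₁) x (<⇒≢ (≤-<-trans (≤-trans e₁<e₂ e₂≤e₃) lt)) =
    trans e (sym (shape-beyond a e₁ e₂ e₃ x (≤-trans (n≤1+n _) e₁<e₂) e₂≤e₃ lt))

shape-twos : ∀ e₁ e₂ → e₁ ≤ e₂ → ∀ x → shape 2 e₁ e₂ e₂ x ≡ shape 2 e₁ e₁ e₂ x
shape-twos e₁ e₂ e₁≤e₂ = rows-shape (shape 2 e₁ e₂ e₂) 2 e₁ e₁ e₂ ≤-refl e₁≤e₂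
  (λ y → shape-first 2 e₁ e₂ e₂ y) (λ y p q → ⊥-elim (<⇒≱ p q))
  (λ y → shape-second 2 e₁ e₂ e₂ y) (λ y → shape-beyond 2 e₁ e₂ e₂ y e₁≤e₂ ≤-refl)

sumBelow-const : ∀ f A K → (∀ x → x < K → f x ≡ A) → sumBelow f K ≡ K * A
sumBelow-const f A zero h = refl
sumBelow-const f A (suc K) h =
  trans (cong₂ _+_ (sumBelow-const f A K (λ x lt → h x (m≤n⇒m≤1+n lt))) (h K ≤-refl)) (+-comm (K * A) A)

sumBelow-+ : ∀ f j k → sumBelow f (j + k) ≡ sumBelow f j + sumBelow (λ i → f (j + i)) k
sumBelow-+ f j zero = trans (cong (sumBelow f) (+-identityʳ j)) (sym (+-identityʳ _))
sumBelow-+ f j (suc k) =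
  trans (cong (sumBelow f) (+-suc j k)) (trans (cong (_+ f (j + k)) (sumBelow-+ f j k)) (+-assoc (sumBelow f j) _ _))

sumBelow-head-ones : ∀ g A p e₃ → p ≤ e₃ → (∀ x → x ≤ p → g x ≡ A) → (∀ x → p < x → x ≤ e₃ → g x ≡ 1) →
  (∀ x → e₃ < x → g x ≡ 0) → ∀ K → e₃ < K → sumBelow g K ≡ suc p * A + (e₃ ∸ p)
sumBelow-head-ones g A p e₃ p≤e₃ head ones zeros K e₃<K = begin
  sumBelow g K                     ≡⟨ sumBelow-stable g (suc e₃) K zeros e₃<K ⟩
  sumBelow g (suc e₃)              ≡⟨ cong (λ z → sumBelow g (suc z)) (sym (m+[n∸m]≡n p≤e₃)) ⟩
  sumBelow g (suc p + (e₃ ∸ p))    ≡⟨ sumBelow-+ g (suc p) (e₃ ∸ p) ⟩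
  sumBelow g (suc p) + sumBelow (λ i → g (suc p + i)) (e₃ ∸ p)
    ≡⟨ cong₂ _+_ (sumBelow-const g A (suc p) (λ x x≤p → head x (≤-pred x≤p)))
                 (trans (sumBelow-const _ 1 (e₃ ∸ p) (λ x lt → ones (suc p + x) (s≤s (m≤m+n p x)) (in-range x lt)))
                        (*-identityʳ _)) ⟩
  suc p * A + (e₃ ∸ p) ∎
  where
  open ≡-Reasoning
  in-range : ∀ x → x < e₃ ∸ p → suc p + x ≤ e₃
  in-range x lt = ≤-trans (≤-reflexive (sym (+-suc p x))) (≤-trans (+-monoʳ-≤ p lt) (≤-reflexive (m+[n∸m]≡n p≤e₃)))

at-replicate-++-< : ∀ k c ys x → x < k → at (replicate k c ++ ys) x ≡ c
at-replicate-++-< (suc k) c ys zero _ = refl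
at-replicate-++-< (suc k) c ys (suc x) (s≤s lt) = at-replicate-++-< k c ys x lt

at-replicate-++-≥ : ∀ k c ys x → k ≤ x → at (replicate k c ++ ys) x ≡ at ys (x ∸ k)
at-replicate-++-≥ zero c ys x _ = refl
at-replicate-++-≥ (suc k) c ys (suc x) (s≤s le) = at-replicate-++-≥ k c ys x le

at-replicate-0 : ∀ k x → at (replicate k 0) x ≡ 0
at-replicate-0 zero x = refl
at-replicate-0 (suc k) zero = refl
at-replicate-0 (suc k) (suc x) = at-replicate-0 k x

at-injective : ∀ (xs ys : List ℕ) → length xs ≡ length ys → (∀ x → at xs x ≡ at ys x) → xs ≡ ys
at-injective [] [] _ _ = refl
at-injective (x ∷ xs) (y ∷ ys) e h = cong₂ _∷_ (h 0) (at-injective xs ys (suc-injective e) (λ i → h (suc i)))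

at-blocks : ∀ A p q zs → (∀ y → at zs y ≡ 0) → ∀ x →
  at (replicate (suc p) A ++ replicate q 1 ++ zs) x ≡ shape A p p (p + q) x
at-blocks A p q zs zeros = rows-shape _ A p p (p + q) ≤-refl (m≤m+n p q)
  (λ y y≤p → at-replicate-++-< (suc p) A _ y (s≤s y≤p))
  (λ y p<y y≤p → ⊥-elim (<⇒≱ p<y y≤p))
  (λ y p<y y≤p+q → trans (at-replicate-++-≥ (suc p) A _ y p<y) (at-replicate-++-< q 1 zs (y ∸ suc p)
     (+-cancelˡ-≤ p _ _ (subst (_≤ p + q) (trans (sym (m+[n∸m]≡n p<y)) (sym (+-suc p _))) y≤p+q))))
  (λ y p+q<y → trans (at-replicate-++-≥ (suc p) A _ y (≤-trans (s≤s (m≤m+n p q)) p+q<y))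
     (trans (at-replicate-++-≥ q 1 zs (y ∸ suc p)
        (+-cancelˡ-≤ (suc p) _ _ (subst (suc p + q ≤_) (sym (m+[n∸m]≡n (≤-trans (s≤s (m≤m+n p q)) p+q<y))) p+q<y)))
       (zeros _)))

length-replicate-++ : ∀ m l z (x y w : ℕ) →
  length (replicate m x ++ replicate l y ++ replicate z w) ≡ m + (l + z)
length-replicate-++ m l z x y w = trans (length-++ (replicate m x))
  (cong₂ _+_ (length-replicate m)
    (trans (length-++ (replicate l y)) (cong₂ _+_ (length-replicate l) (length-replicate z))))

plateau-constant : ∀ {N} (v : Vec ℕ N) → NonIncreasing (row v) → ∀ k →
  (∀ i → 1 ≤ i → i < k → d v i ≡ 0) → ∀ x → x < k → row v x ≡ row v 0
plateau-constant v ni k flat zero _ = refl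
plateau-constant v ni k flat (suc x) lt =
  trans (≤-antisym (ni x) (m∸n≡0⇒m≤n (flat (suc x) (s≤s z≤n) lt)))
        (plateau-constant v ni k flat x (≤-trans (n≤1+n _) lt))

shape-plateau : ∀ {N} (v : Vec ℕ N) a e₁ e₂ e₃ → (∀ x → row v x ≡ shape a e₁ e₂ e₃ x) →
  ∀ i → 1 ≤ i → i < suc e₁ → d v i ≡ 0
shape-plateau v a e₁ e₂ e₃ rows (suc i) _ (s≤s i<e₁) =
  trans (cong₂ _∸_ (trans (rows i) (shape-first a e₁ e₂ e₃ i (≤-trans (n≤1+n i) i<e₁)))
                   (trans (rows (suc i)) (shape-first a e₁ e₂ e₃ (suc i) i<e₁))) (n∸n≡0 a)

-- The families of ShapeCond with e₁ = e₂, whose partitions have a cliff at row e₁.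
CliffCond : ℕ → ℕ → ℕ → Set
CliffCond a e e₃ = (e₃ ≡ e × 2 ≤ a) ⊎ (e < e₃ × 3 ≤ a)

cliffCond-shapeCond : ∀ {a e e₃} → CliffCond a e e₃ → ShapeCond a e e e₃
cliffCond-shapeCond (inj₁ (e₃≡e , 2≤a)) = ≤-refl , ≤-reflexive (sym e₃≡e) , 2≤a , inj₁ (refl , e₃≡e)
cliffCond-shapeCond (inj₂ (e<e₃ , 3≤a)) = ≤-refl , <⇒≤ e<e₃ , ≤-trans (n≤1+n 2) 3≤a , inj₂ (inj₁ (refl , e<e₃ , 3≤a))

shape-cliff : ∀ a e e₃ → CliffCond a e e₃ → 2 ≤ shape a e e e₃ e ∸ shape a e e e₃ (suc e)
shape-cliff a e e₃ (inj₁ (e₃≡e , 2≤a))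
  rewrite shape-first a e e e₃ e ≤-refl
        | shape-beyond a e e e₃ (suc e) ≤-refl (≤-reflexive (sym e₃≡e)) (s≤s (≤-reflexive e₃≡e)) = 2≤a
shape-cliff a e e₃ (inj₂ (e<e₃ , 3≤a))
  rewrite shape-first a e e e₃ e ≤-refl | shape-third a e e e₃ (suc e) ≤-refl ≤-refl e<e₃ = ∸-monoˡ-≤ 1 3≤a

joinIrrShape-¬321 : ∀ N (V : Vec ℕ N) → JoinIrrShape N V →
  ∀ x → row V x ≡ 3 → row V (suc x) ≡ 2 → row V (suc (suc x)) ≡ 1 → ⊥
joinIrrShape-¬321 N V (a , e₁ , e₂ , e₃ , (e₁≤e₂ , e₂≤e₃ , _ , fam) , rows) x r₀ r₁ r₂
  with shape-cases a e₁ e₂ e₃ (suc x) e₁≤e₂ e₂≤e₃ | shape-cases a e₁ e₂ e₃ (suc (suc x)) e₁≤e₂ e₂≤e₃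
... | inj₁ (le , e) | _ = contradiction (trans (sym r₀) (trans (rows x)
        (trans (shape-first a e₁ e₂ e₃ x (≤-trans (n≤1+n x) le)) (trans (sym e) (trans (sym (rows _)) r₁))))) λ ()
... | inj₂ (inj₂ (inj₁ (_ , _ , e))) | _ = contradiction (trans (sym r₁) (trans (rows _) e)) λ ()
... | inj₂ (inj₂ (inj₂ (_ , e))) | _ = contradiction (trans (sym r₁) (trans (rows _) e)) λ ()
... | inj₂ (inj₁ (lt , _)) | inj₁ (le , _) = <⇒≱ lt (≤-trans (n≤1+n _) le)
... | inj₂ (inj₁ (_ , _ , e)) | inj₂ (inj₁ (_ , _ , e′)) =
  contradiction (trans (sym r₁) (trans (rows _) (trans e (trans (sym e′) (trans (sym (rows _)) r₂))))) λ ()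
... | inj₂ (inj₁ _) | inj₂ (inj₂ (inj₂ (_ , e′))) = contradiction (trans (sym r₂) (trans (rows _) e′)) λ ()
... | inj₂ (inj₁ (lt₁ , le₁ , e)) | inj₂ (inj₂ (inj₁ (lt₂ , le₂ , _))) with fam
...   | inj₁ (e₂≡e₁ , _) = <-irrefl (sym e₂≡e₁) (<-≤-trans lt₁ le₁)
...   | inj₂ (inj₁ (e₂≡e₁ , _)) = <-irrefl (sym e₂≡e₁) (<-≤-trans lt₁ le₁)
...   | inj₂ (inj₂ (inj₁ (_ , e₃≡e₂))) = <-irrefl (sym e₃≡e₂) (<-≤-trans lt₂ le₂)
...   | inj₂ (inj₂ (inj₂ (_ , _ , 4≤a))) =
  contradiction (subst (3 ≤_) (trans (sym e) (trans (sym (rows _)) r₁)) (∸-monoˡ-≤ 1 4≤a)) λ { (s≤s (s≤s ())) }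

cliff-after-plateau : ∀ {k} (v : Vec ℕ k) e → 2 ≤ d v (suc e) → (∀ i → 1 ≤ i → i < suc e → d v i ≡ 0) →
  Cliff v 1 ⊎ NonSlipPlateau v 1
cliff-after-plateau v zero cliff _ = inj₁ cliff
cliff-after-plateau v (suc e) cliff flat = inj₂ (suc (suc e) , s≤s (s≤s z≤n) , flat , cliff)

step-at-head : ∀ n (α : Vec ℕ n) a e₂ e₃ → 0 < n → IsPartition n α → (∀ x → row α x ≡ shape a 0 e₂ e₃ x) →
  0 < e₂ → e₂ ≤ e₃ → 2 ≤ a → (e₃ ≡ e₂ ⊎ (e₂ < e₃ × 4 ≤ a)) → Ss n α ⊎ NS n α
step-at-head n α a e₂ e₃ 0<n pα rows 0<e₂ e₂≤e₃ 2≤a side = step side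
  where
  w : Vec ℕ n
  w = decAt α 1
  rows-w : ∀ x → row w x ≡ shape (a ∸ 1) e₂ e₂ e₃ x
  rows-w x = trans (row-decAt α 0 x) (trans (cong (_∸ δ 0 x) (rows x)) (shape-removeCell-head a e₂ e₃ e₂≤e₃ x))
  1≤α₁ : 1 ≤ α ! 1
  1≤α₁ = subst (1 ≤_) (sym (trans (rows 0) (shape-first a 0 e₂ e₃ 0 z≤n))) (≤-trans (s≤s z≤n) 2≤a)
  pw : IsPartition (n ∸ 1) w
  pw = (λ x → subst₂ _≤_ (sym (rows-w (suc x))) (sym (rows-w x))
          (shape-nonIncreasing (a ∸ 1) e₂ e₂ e₃ ≤-refl e₂≤e₃ (∸-monoˡ-≤ 1 2≤a)
                               (λ e₂<e₂ _ → ⊥-elim (<-irrefl refl e₂<e₂)) x)) ,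
       trans (sum≡sumBelow w) (trans (sumBelow-cong _ _ n (λ x _ → row-decAt α 0 x))
         (cong (_∸ 1) (trans (sumBelow-removeCell (row α) 0 n 0<n 1≤α₁) (proj₁ (proj₂ (row-isPartitionᶠ α pα))))))
  plateau : ∀ i → 1 ≤ i → i < suc e₂ → d w i ≡ 0
  plateau = shape-plateau w (a ∸ 1) e₂ e₂ e₃ rows-w
  d-w : d w (suc e₂) ≡ shape (a ∸ 1) e₂ e₂ e₃ e₂ ∸ shape (a ∸ 1) e₂ e₂ e₃ (suc e₂)
  d-w = cong₂ _∸_ (rows-w e₂) (rows-w (suc e₂))
  non-slippery : CliffCond (a ∸ 1) e₂ e₃ → NS n α
  non-slippery cc = 1≤α₁ , pw , suc e₂ , s≤s 0<e₂ , plateau , subst (2 ≤_) (sym d-w) (shape-cliff (a ∸ 1) e₂ e₃ cc)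
  step : (e₃ ≡ e₂ ⊎ (e₂ < e₃ × 4 ≤ a)) → Ss n α ⊎ NS n α
  step (inj₁ e₃≡e₂) with a ≟ 2
  ... | yes refl = inj₁ (1≤α₁ , pw , e₂ , suc e₂ , s≤s 0<e₂ , refl , plateau ,
          trans d-w (cong₂ _∸_ (shape-first 1 e₂ e₂ e₃ e₂ ≤-refl)
                               (shape-beyond 1 e₂ e₂ e₃ (suc e₂) ≤-refl e₂≤e₃ (s≤s (≤-reflexive e₃≡e₂)))))
  ... | no a≢2 = inj₂ (non-slippery (inj₁ (e₃≡e₂ , ∸-monoˡ-≤ 1 (≤∧≢⇒< 2≤a (λ e → a≢2 (sym e))))))
  step (inj₂ (e₂<e₃ , 4≤a)) = inj₂ (non-slippery (inj₂ (e₂<e₃ , ∸-monoˡ-≤ 1 4≤a)))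

slippery-plateau : ∀ n (α : Vec ℕ n) a l e₂ e₃ → (∀ x → row α x ≡ shape a (suc l) e₂ e₃ x) →
  suc l < e₂ → 1 ≤ a → PP (suc l) n α
slippery-plateau n α a l e₂ e₃ rows l<e₂ 1≤a = suc (suc l) , s≤s (s≤s z≤n) , refl ,
  shape-plateau α a (suc l) e₂ e₃ rows ,
  trans (cong₂ _∸_ (trans (rows (suc l)) (shape-first a (suc l) e₂ e₃ (suc l) ≤-refl))
                   (trans (rows (suc (suc l))) (shape-second a (suc l) e₂ e₃ (suc (suc l)) ≤-refl l<e₂)))
        (m∸[m∸n]≡n 1≤a)

module Preimage (n : ℕ) (3≤n : 3 ≤ n) (γ : Vec ℕ (suc n)) (pγ : IsPartition (suc n) γ) where

  private
    g = row γ
    sum-g : sumBelow g (suc n) ≡ suc n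
    sum-g = proj₁ (proj₂ (row-isPartitionᶠ γ pγ))
    0<n : 0 < n
    0<n = ≤-trans (s≤s z≤n) 3≤n

  InImage : Set
  InImage = Σ (Vec ℕ n) λ α → JoinIrr n α × EtaGraph n α γ

  E1-of-shape : ∀ e → (∀ x → g x ≡ shape 2 0 e e x) → e < n → E1 n γ
  E1-of-shape e rows e<n = subst (λ z → toList γ ≡ 2 ∷ (replicate z 1 ++ 0 ∷ [])) (sym (cong (_∸ 1) n≡1+e)) list
    where
    rows′ : ∀ x → g x ≡ shape 2 0 0 e x
    rows′ x = trans (rows x) (shape-twos 0 e z≤n x)
    n≡1+e : n ≡ suc e
    n≡1+e = suc-injective (trans (sym sum-g) (sumBelow-head-ones g 2 0 e z≤n
      (λ x x≤0 → trans (rows′ x) (shape-first 2 0 0 e x x≤0))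
      (λ x 0<x x≤e → trans (rows′ x) (shape-third 2 0 0 e x z≤n 0<x x≤e))
      (λ x e<x → trans (rows′ x) (shape-beyond 2 0 0 e x z≤n z≤n e<x)) (suc n) (s≤s (<⇒≤ e<n))))
    list : toList γ ≡ 2 ∷ (replicate e 1 ++ 0 ∷ [])
    list = at-injective _ _
      (trans (length-toList γ) (cong suc (trans n≡1+e (sym (trans (length-++ (replicate e 1))
        (trans (cong (_+ 1) (length-replicate e)) (+-comm e 1)))))))
      (λ x → trans (rows′ x) (sym (at-blocks 2 0 e (0 ∷ []) (at-replicate-0 1) x)))

  E2-of-shape : ∀ p e₃ → (∀ x → g x ≡ shape 3 p p e₃ x) → p < e₃ → e₃ < n → E2 n γ
  E2-of-shape p e₃ rows p<e₃ e₃<n = suc p , l , s≤s z≤n , m<n⇒0<n∸m p<e₃ , sum-3 , list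
    where
    l = e₃ ∸ p
    p+l≡e₃ : p + l ≡ e₃
    p+l≡e₃ = m+[n∸m]≡n (<⇒≤ p<e₃)
    sum-3 : 3 * suc p + l ≡ suc n
    sum-3 = trans (cong (_+ l) (*-comm 3 (suc p))) (trans (sym (sumBelow-head-ones g 3 p e₃ (<⇒≤ p<e₃)
      (λ x x≤p → trans (rows x) (shape-first 3 p p e₃ x x≤p))
      (λ x p<x x≤e₃ → trans (rows x) (shape-third 3 p p e₃ x ≤-refl p<x x≤e₃))
      (λ x e₃<x → trans (rows x) (shape-beyond 3 p p e₃ x ≤-refl (<⇒≤ p<e₃) e₃<x))
      (suc n) (≤-trans e₃<n (n≤1+n n)))) sum-g)
    zeros = suc n ∸ (suc p + l)
    list : toList γ ≡ replicate (suc p) 3 ++ replicate l 1 ++ replicate zeros 0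
    list = at-injective _ _
      (trans (length-toList γ) (sym (trans (length-replicate-++ (suc p) l zeros 3 1 0)
        (trans (sym (+-assoc (suc p) l zeros)) (m+[n∸m]≡n (s≤s (≤-trans (≤-reflexive p+l≡e₃) (<⇒≤ e₃<n))))))))
      (λ x → trans (rows x) (trans (cong (λ z → shape 3 p p z x) (sym p+l≡e₃))
                                   (sym (at-blocks 3 p l (replicate zeros 0) (at-replicate-0 zeros) x))))

  module _ (gn≡0 : g n ≡ 0) where

    in-image-of-head : ∀ a e₂ e₃ → (∀ x → g x ≡ shape a 0 e₂ e₃ x) → 2 ≤ a → CliffCond (a ∸ 1) e₂ e₃ → InImage
    in-image-of-head a e₂ e₃ rows 2≤a cc
      with removeCell-joinIrr n γ pγ gn≡0 0 0<n 1≤g₀ (a ∸ 1) e₂ e₂ e₃ (cliffCond-shapeCond cc) removed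
      where
      1≤g₀ : 1 ≤ g 0
      1≤g₀ = subst (1 ≤_) (sym (trans (rows 0) (shape-first a 0 e₂ e₃ 0 z≤n))) (≤-trans (s≤s z≤n) 2≤a)
      removed : ∀ x → removeCell g 0 x ≡ shape (a ∸ 1) e₂ e₂ e₃ x
      removed x = trans (cong (_∸ δ 0 x) (rows x))
        (shape-removeCell-head a e₂ e₃ (proj₁ (proj₂ (cliffCond-shapeCond cc))) x)
    ... | α , Jα , rows-α , γ≡down = α , Jα , inj₁ (cliff-after-plateau α e₂
      (subst₂ (λ u w → 2 ≤ u ∸ w) (sym (rows-α e₂)) (sym (rows-α (suc e₂))) (shape-cliff (a ∸ 1) e₂ e₃ cc))
      (shape-plateau α (a ∸ 1) e₂ e₂ e₃ rows-α) , γ≡down)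

    in-image-of-end : ∀ a l e₂ e₃ → (∀ x → g x ≡ shape a (suc l) e₂ e₃ x) → suc l ≤ e₂ → e₂ ≤ e₃ → e₃ < n →
      2 ≤ a → (e₃ ≡ e₂ ⊎ (e₂ < e₃ × 4 ≤ a)) → InImage
    in-image-of-end a l e₂ e₃ rows l<e₂ e₂≤e₃ e₃<n 2≤a side
      with removeCell-joinIrr n γ pγ gn≡0 (suc l) l<n 1≤g a l e₂ e₃ cond removed
      where
      l<n : suc l < n
      l<n = ≤-<-trans (≤-trans l<e₂ e₂≤e₃) e₃<n
      1≤g : 1 ≤ g (suc l)
      1≤g = subst (1 ≤_) (sym (trans (rows (suc l)) (shape-first a (suc l) e₂ e₃ (suc l) ≤-refl)))
                  (≤-trans (s≤s z≤n) 2≤a)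
      cond : ShapeCond a l e₂ e₃
      cond = ≤-trans (n≤1+n l) l<e₂ , e₂≤e₃ , 2≤a , family side
        where
        family : (e₃ ≡ e₂ ⊎ (e₂ < e₃ × 4 ≤ a)) → ShapeFamily a l e₂ e₃
        family (inj₁ e₃≡e₂) = inj₂ (inj₂ (inj₁ (l<e₂ , e₃≡e₂)))
        family (inj₂ (e₂<e₃ , 4≤a)) = inj₂ (inj₂ (inj₂ (l<e₂ , e₂<e₃ , 4≤a)))
      removed : ∀ x → removeCell g (suc l) x ≡ shape a l e₂ e₃ x
      removed x = trans (cong (_∸ δ (suc l) x) (rows x)) (shape-removeCell-end a l e₂ e₃ l<e₂ e₂≤e₃ x)
    ... | α , Jα , rows-α , γ≡down = α , Jα , eta l rows-α l<e₂ γ≡down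
      where
      eta : ∀ l → (∀ x → row α x ≡ shape a l e₂ e₃ x) → suc l ≤ e₂ → γ ≡ down α (suc (suc l)) → EtaGraph n α γ
      eta zero rows-α 0<e₂ γ≡down =
        inj₂ (inj₁ (step-at-head n α a e₂ e₃ 0<n (proj₁ Jα) rows-α 0<e₂ e₂≤e₃ 2≤a side , γ≡down))
      eta (suc l′) rows-α l<e₂ γ≡down = inj₂ (inj₂ (suc l′ , s≤s z≤n ,
        ≤-<-trans (≤-trans (n≤1+n _) l<e₂) (≤-<-trans e₂≤e₃ e₃<n) ,
        slippery-plateau n α a l′ e₂ e₃ rows-α l<e₂ (≤-trans (s≤s z≤n) 2≤a) ,
        trans γ≡down (cong (down α) (+-comm 2 (suc l′)))))

  private
    shape-end : ∀ a e₁ e₂ e₃ → ShapeCond a e₁ e₂ e₃ → (∀ x → g x ≡ shape a e₁ e₂ e₃ x) → e₃ < n × g n ≡ 0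
    shape-end a e₁ e₂ e₃ (e₁≤e₂ , e₂≤e₃ , 2≤a , _) rows =
      e₃<n , trans (rows n) (shape-beyond a e₁ e₂ e₃ n e₁≤e₂ e₂≤e₃ e₃<n)
      where
      e₃<n : e₃ < n
      e₃<n = ≤-pred (positive-row-not-last (suc n) g (row-isPartitionᶠ γ pγ)
        (subst (2 ≤_) (sym (trans (rows 0) (shape-first a e₁ e₂ e₃ 0 z≤n))) 2≤a)
        e₃ (subst (1 ≤_) (sym (rows e₃)) (shape-pos a e₁ e₂ e₃ e₁≤e₂ e₂≤e₃ 2≤a)))

    exact : ∀ {a b} → b ≤ a → ¬ (suc b ≤ a) → a ≡ b
    exact b≤a ¬b<a = ≤-antisym (≤-pred (≰⇒> ¬b<a)) b≤a

  module _ (a e₂ e₃ : ℕ) (cond : ShapeCond a 0 e₂ e₃) (rows : ∀ x → g x ≡ shape a 0 e₂ e₃ x)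
           (e₃<n : e₃ < n) (gn≡0 : g n ≡ 0) (¬img : ¬ InImage) where

    private
      e₂≤e₃ : e₂ ≤ e₃
      e₂≤e₃ = proj₁ (proj₂ cond)
      2≤a : 2 ≤ a
      2≤a = proj₁ (proj₂ (proj₂ cond))
      image : CliffCond (a ∸ 1) e₂ e₃ → InImage
      image = in-image-of-head gn≡0 a e₂ e₃ rows 2≤a

    exceptional-of-head : ShapeFamily a 0 e₂ e₃ → E1 n γ ⊎ E2 n γ
    exceptional-of-head (inj₁ (e₂≡0 , e₃≡0)) with 3 ≤? a
    ... | yes 3≤a = ⊥-elim (¬img (image (inj₁ (trans e₃≡0 (sym e₂≡0) , ∸-monoˡ-≤ 1 3≤a))))
    ... | no 3≰a = contradiction (subst (3 ≤_) n≡1 3≤n) λ { (s≤s ()) }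
      where
      a≡2 : a ≡ 2
      a≡2 = exact 2≤a 3≰a
      n≡1 : n ≡ 1
      n≡1 = suc-injective (trans (sym sum-g) (sumBelow-head-ones g 2 0 0 z≤n
        (λ x x≤0 → trans (rows x) (trans (shape-first a 0 e₂ e₃ x x≤0) a≡2)) (λ x p q → ⊥-elim (<⇒≱ p q))
        (λ x 0<x → trans (rows x) (shape-beyond a 0 e₂ e₃ x z≤n e₂≤e₃ (subst (_< x) (sym e₃≡0) 0<x)))
        (suc n) (s≤s z≤n)))
    exceptional-of-head (inj₂ (inj₁ (e₂≡0 , 0<e₃ , 3≤a))) with 4 ≤? a
    ... | yes 4≤a = ⊥-elim (¬img (image (inj₂ (subst (_< e₃) (sym e₂≡0) 0<e₃ , ∸-monoˡ-≤ 1 4≤a))))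
    ... | no 4≰a = inj₂ (E2-of-shape 0 e₃
          (λ x → trans (rows x) (cong₂ (λ A E → shape A 0 E e₃ x) (exact 3≤a 4≰a) e₂≡0)) 0<e₃ e₃<n)
    exceptional-of-head (inj₂ (inj₂ (inj₁ (_ , e₃≡e₂)))) with 3 ≤? a
    ... | yes 3≤a = ⊥-elim (¬img (image (inj₁ (e₃≡e₂ , ∸-monoˡ-≤ 1 3≤a))))
    ... | no 3≰a = inj₁ (E1-of-shape e₂
          (λ x → trans (rows x) (cong₂ (λ A E → shape A 0 e₂ E x) (exact 2≤a 3≰a) e₃≡e₂)) (subst (_< n) e₃≡e₂ e₃<n))
    exceptional-of-head (inj₂ (inj₂ (inj₂ (_ , e₂<e₃ , 4≤a)))) =
      ⊥-elim (¬img (image (inj₂ (e₂<e₃ , ∸-monoˡ-≤ 1 4≤a))))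

  module _ (a l e₂ e₃ : ℕ) (cond : ShapeCond a (suc l) e₂ e₃) (rows : ∀ x → g x ≡ shape a (suc l) e₂ e₃ x)
           (e₃<n : e₃ < n) (gn≡0 : g n ≡ 0) (¬img : ¬ InImage) where

    private
      image : (e₃ ≡ e₂ ⊎ (e₂ < e₃ × 4 ≤ a)) → InImage
      image = in-image-of-end gn≡0 a l e₂ e₃ rows (proj₁ cond) (proj₁ (proj₂ cond)) e₃<n (proj₁ (proj₂ (proj₂ cond)))

    exceptional-of-end : ShapeFamily a (suc l) e₂ e₃ → E1 n γ ⊎ E2 n γ
    exceptional-of-end (inj₁ (e₂≡e₁ , e₃≡e₁)) = ⊥-elim (¬img (image (inj₁ (trans e₃≡e₁ (sym e₂≡e₁)))))
    exceptional-of-end (inj₂ (inj₁ (e₂≡e₁ , e₁<e₃ , 3≤a))) with 4 ≤? a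
    ... | yes 4≤a = ⊥-elim (¬img (image (inj₂ (subst (_< e₃) (sym e₂≡e₁) e₁<e₃ , 4≤a))))
    ... | no 4≰a = inj₂ (E2-of-shape (suc l) e₃
          (λ x → trans (rows x) (cong₂ (λ A E → shape A (suc l) E e₃ x) (exact 3≤a 4≰a) e₂≡e₁)) e₁<e₃ e₃<n)
    exceptional-of-end (inj₂ (inj₂ (inj₁ (_ , e₃≡e₂)))) = ⊥-elim (¬img (image (inj₁ e₃≡e₂)))
    exceptional-of-end (inj₂ (inj₂ (inj₂ (_ , e₂<e₃ , 4≤a)))) = ⊥-elim (¬img (image (inj₂ (e₂<e₃ , 4≤a))))

  outside-image⇒exceptional : JoinIrr (suc n) γ → ¬ InImage → E1 n γ ⊎ E2 n γ
  outside-image⇒exceptional J ¬img with Classification.joinIrr⇒shape (suc n) γ J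
  ... | a , zero , e₂ , e₃ , cond , rows with shape-end a 0 e₂ e₃ cond rows
  ...   | e₃<n , gn≡0 = exceptional-of-head a e₂ e₃ cond rows e₃<n gn≡0 ¬img (proj₂ (proj₂ (proj₂ cond)))
  outside-image⇒exceptional J ¬img | a , suc l , e₂ , e₃ , cond , rows with shape-end a (suc l) e₂ e₃ cond rows
  ...   | e₃<n , gn≡0 = exceptional-of-end a l e₂ e₃ cond rows e₃<n gn≡0 ¬img (proj₂ (proj₂ (proj₂ cond)))

module NotInImage (n : ℕ) (3≤n : 3 ≤ n) (γ : Vec ℕ (suc n)) (α : Vec ℕ n) (Jα : JoinIrr n α) where

  private
    g = row γ
    f = row α
    pf : IsPartitionᶠ n f
    pf = row-isPartitionᶠ α (proj₁ Jα)
    ni : NonIncreasing f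
    ni = proj₁ pf
    1≤n : 1 ≤ n
    1≤n = ≤-trans (s≤s z≤n) 3≤n

    rows-down : ∀ r → r ≤ n → γ ≡ down α (suc r) → ∀ x → g x ≡ f x + δ r x
    rows-down r r≤n eq x = trans (cong (λ w → row w x) eq) (row-down α r r≤n x)

    unchanged : ∀ r {x} → g x ≡ f x + δ r x → r ≢ x → f x ≡ g x
    unchanged r {x} e r≢x = sym (trans e (trans (cong (f x +_) (δ-≢ r x r≢x)) (+-identityʳ _)))

    changed : ∀ r → g r ≡ f r + δ r r → g r ≡ suc (f r)
    changed r e = trans e (trans (cong (f r +_) (δ-refl r)) (+-comm (f r) 1))

    rows-down-plateau : ∀ l → l < n → γ ≡ down α (l + 2) → ∀ x → g x ≡ f x + δ (suc l) x
    rows-down-plateau l l<n eq = rows-down (suc l) l<n (trans eq (cong (down α) (+-comm l 2)))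

  ¬E1 : ∀ e → (∀ x → g x ≡ shape 2 0 e e x) → 1 < e → ¬ EtaGraph n α γ
  ¬E1 e rows 1<e (inj₁ (_ , eq)) = ¬joinIrr-of-rows≤1 n α Jα
    (≤-pred (≤-reflexive (trans (sym (changed 0 (rows-down 0 z≤n eq 0))) (trans (rows 0) (shape-first 2 0 e e 0 z≤n)))))
  ¬E1 e rows 1<e (inj₂ (inj₁ (_ , eq))) = contradiction (subst (3 ≤_) n≡2 3≤n) λ { (s≤s (s≤s ())) }
    where
    f₁≡0 : f 1 ≡ 0
    f₁≡0 = suc-injective (trans (sym (changed 1 (rows-down 1 1≤n eq 1)))
                                (trans (rows 1) (shape-second 2 0 e e 1 (s≤s z≤n) (<⇒≤ 1<e))))
    f₀≡2 : f 0 ≡ 2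
    f₀≡2 = trans (unchanged 1 (rows-down 1 1≤n eq 0) λ ()) (trans (rows 0) (shape-first 2 0 e e 0 z≤n))
    n≡2 : n ≡ 2
    n≡2 = trans (sym (proj₁ (proj₂ pf))) (trans (sumBelow-stable f 1 n (nonIncreasing-zero f ni 0 f₁≡0) 1≤n) f₀≡2)
  ¬E1 e rows 1<e (inj₂ (inj₂ (suc l , _ , l<n , (k , 1<k , _ , flat , _) , eq))) =
    contradiction (trans (sym (cong₂ _∸_ f₀≡2 f₁≡1)) (flat 1 ≤-refl 1<k)) λ ()
    where
    g-rows : ∀ x → g x ≡ f x + δ (suc (suc l)) x
    g-rows = rows-down-plateau (suc l) l<n eq
    f₀≡2 : f 0 ≡ 2
    f₀≡2 = trans (unchanged (suc (suc l)) (g-rows 0) λ ()) (trans (rows 0) (shape-first 2 0 e e 0 z≤n))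
    f₁≡1 : f 1 ≡ 1
    f₁≡1 = trans (unchanged (suc (suc l)) (g-rows 1) λ ()) (trans (rows 1) (shape-second 2 0 e e 1 (s≤s z≤n) (<⇒≤ 1<e)))

  module _ (m l′ : ℕ) (rows : ∀ x → g x ≡ shape 3 m m (m + suc l′) x) where

    private
      e₃ = m + suc l′
      m<e₃ : m < e₃
      m<e₃ = m<m+n m (s≤s z≤n)
      g₀≡3 : g 0 ≡ 3
      g₀≡3 = trans (rows 0) (shape-first 3 m m e₃ 0 z≤n)
      g-in-head : ∀ x → x ≤ m → g x ≡ 3
      g-in-head x x≤m = trans (rows x) (shape-first 3 m m e₃ x x≤m)
      g-after-head : ∀ x → m < x → x ≤ e₃ → g x ≡ 1
      g-after-head x m<x x≤e₃ = trans (rows x) (shape-third 3 m m e₃ x ≤-refl m<x x≤e₃)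
      g≡3⇒in-head : ∀ x → g x ≡ 3 → x ≤ m
      g≡3⇒in-head x g≡3 with shape-cases 3 m m e₃ x ≤-refl (<⇒≤ m<e₃)
      ... | inj₁ (x≤m , _) = x≤m
      ... | inj₂ (inj₁ (lt , le , _)) = ⊥-elim (<⇒≱ lt le)
      ... | inj₂ (inj₂ (inj₁ (_ , _ , e))) = contradiction (trans (sym g≡3) (trans (rows x) e)) λ ()
      ... | inj₂ (inj₂ (inj₂ (_ , e))) = contradiction (trans (sym g≡3) (trans (rows x) e)) λ ()
      ¬321 : ∀ x → f x ≡ 3 → f (suc x) ≡ 2 → f (suc (suc x)) ≡ 1 → ⊥
      ¬321 = joinIrrShape-¬321 n α (Classification.joinIrr⇒shape n α Jα)
      in-tail : ∀ {x} → suc x ≤ m → suc (suc x) ≤ e₃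
      in-tail x<m = ≤-trans (s≤s x<m) m<e₃

    ¬E2-head : Cl n α ⊎ NP n α → γ ≡ down α 1 → ⊥
    ¬E2-head cliff-or-plateau eq = from-head (1 ≤? m)
      where
      g-rows : ∀ x → g x ≡ f x + δ 0 x
      g-rows = rows-down 0 z≤n eq
      f₀≡2 : f 0 ≡ 2
      f₀≡2 = suc-injective (trans (sym (changed 0 (g-rows 0))) g₀≡3)
      from-head : Dec (1 ≤ m) → ⊥
      from-head (yes 1≤m) =
        <⇒≱ (subst₂ _<_ (sym f₀≡2) (sym (trans (unchanged 0 (g-rows 1) λ ()) (g-in-head 1 1≤m))) ≤-refl) (ni 0)
      from-head (no 1≰m) = not-cliff cliff-or-plateau
        where
        d₁≡1 : d α 1 ≡ 1
        d₁≡1 = cong₂ _∸_ f₀≡2 (trans (unchanged 0 (g-rows 1) λ ()) (g-after-head 1 (≰⇒> 1≰m) (≤-trans (s≤s z≤n) m<e₃)))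
        not-cliff : Cl n α ⊎ NP n α → ⊥
        not-cliff (inj₁ cliff) = <⇒≱ cliff (≤-reflexive d₁≡1)
        not-cliff (inj₂ (k , 1<k , flat , _)) = contradiction (trans (sym d₁≡1) (flat 1 ≤-refl 1<k)) λ ()
    ¬E2-step : Ss n α ⊎ NS n α → γ ≡ down α 2 → ⊥
    ¬E2-step step eq = from-step (2 ≤? m)
      where
      g-rows : ∀ x → g x ≡ f x + δ 1 x
      g-rows = rows-down 1 1≤n eq
      f₀≡3 : f 0 ≡ 3
      f₀≡3 = trans (unchanged 1 (g-rows 0) λ ()) g₀≡3
      step-plateau : Ss n α ⊎ NS n α → d (decAt α 1) 1 ≡ 0
      step-plateau (inj₁ (_ , _ , _ , _ , 1<k , _ , flat , _)) = flat 1 ≤-refl 1<k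
      step-plateau (inj₂ (_ , _ , _ , 1<k , flat , _)) = flat 1 ≤-refl 1<k
      2≤f₁ : 2 ≤ f 1
      2≤f₁ = m∸n≡0⇒m≤n (subst (λ z → (z ∸ 1) ∸ f 1 ≡ 0) f₀≡3
               (trans (sym (cong₂ _∸_ (row-decAt α 0 0) (row-decAt α 0 1))) (step-plateau step)))
      f₁≡2 : f 1 ≡ 2
      f₁≡2 = ≤-antisym (≤-pred (subst (_≤ 3) (changed 1 (g-rows 1)) (subst (_≤ 3) (sym (rows 1))
               (shape-≤-head 3 m m e₃ 1 (s≤s z≤n))))) 2≤f₁
      1≤m : 1 ≤ m
      1≤m = g≡3⇒in-head 1 (trans (changed 1 (g-rows 1)) (cong suc f₁≡2))
      from-step : Dec (2 ≤ m) → ⊥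
      from-step (yes 2≤m) =
        <⇒≱ (subst₂ _<_ (sym f₁≡2) (sym (trans (unchanged 1 (g-rows 2) λ ()) (g-in-head 2 2≤m))) ≤-refl) (ni 1)
      from-step (no 2≰m) =
        ¬321 0 f₀≡3 f₁≡2 (trans (unchanged 1 (g-rows 2) λ ()) (g-after-head 2 (≰⇒> 2≰m) (in-tail 1≤m)))
    ¬E2-plateau : ∀ l → l < n → PP l n α → γ ≡ down α (l + 2) → ⊥
    ¬E2-plateau l l<n (k , 1<k , l≡k∸1 , flat , d-k≡1) eq = ¬321 l f-l≡3 f-l+1≡2 f-l+2≡1
      where
      g-rows : ∀ x → g x ≡ f x + δ (suc l) x
      g-rows = rows-down-plateau l l<n eq
      k≡1+l : k ≡ suc l
      k≡1+l = trans (sym (m∸n+n≡m (<⇒≤ 1<k))) (trans (+-comm (k ∸ 1) 1) (cong suc (sym l≡k∸1)))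
      f-l≡3 : f l ≡ 3
      f-l≡3 = trans (plateau-constant α ni k flat l (subst (l <_) (sym k≡1+l) ≤-refl))
                    (trans (unchanged (suc l) (g-rows 0) λ ()) g₀≡3)
      f-l+1≤3 : f (suc l) ≤ 3
      f-l+1≤3 = ≤-trans (ni l) (≤-reflexive f-l≡3)
      f-l+1≡2 : f (suc l) ≡ 2
      f-l+1≡2 = trans (sym (m∸[m∸n]≡n f-l+1≤3))
        (cong (3 ∸_) (trans (cong (_∸ f (suc l)) (sym f-l≡3)) (subst (λ z → d α z ≡ 1) k≡1+l d-k≡1)))
      l<m : suc l ≤ m
      l<m = g≡3⇒in-head (suc l) (trans (changed (suc l) (g-rows (suc l))) (cong suc f-l+1≡2))
      f-l+2≡g : f (suc (suc l)) ≡ g (suc (suc l))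
      f-l+2≡g = unchanged (suc l) (g-rows (suc (suc l))) (<⇒≢ ≤-refl)
      m<l+2 : m < suc (suc l)
      m<l+2 = ≰⇒> λ l+2≤m → contradiction
        (subst (_≤ 2) (trans f-l+2≡g (g-in-head _ l+2≤m)) (≤-trans (ni (suc l)) (≤-reflexive f-l+1≡2)))
        λ { (s≤s (s≤s ())) }
      f-l+2≡1 : f (suc (suc l)) ≡ 1
      f-l+2≡1 = trans f-l+2≡g (g-after-head _ m<l+2 (in-tail l<m))

    -- In the last two cases α would contain the rows 3, 2, 1, which no join-irreducible shape has.
    ¬E2 : ¬ EtaGraph n α γ
    ¬E2 (inj₁ (cliff-or-plateau , eq)) = ¬E2-head cliff-or-plateau eq
    ¬E2 (inj₂ (inj₁ (step , eq))) = ¬E2-step step eq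
    ¬E2 (inj₂ (inj₂ (l , _ , l<n , plateau , eq))) = ¬E2-plateau l l<n plateau eq

exceptional⇒outside-image : ∀ n → 3 ≤ n → (γ : Vec ℕ (suc n)) → E1 n γ ⊎ E2 n γ →
  JoinIrr (suc n) γ × ¬ (Σ (Vec ℕ n) λ α → JoinIrr n α × EtaGraph n α γ)
exceptional⇒outside-image n 3≤n γ (inj₁ list) =
  shape⇒joinIrr (suc n) γ (shape-isPartition (suc n) γ 2 0 e e cond rows total) 2 0 e e cond rows ,
  λ { (α , Jα , η) → NotInImage.¬E1 n 3≤n γ α Jα e rows 1<e η }
  where
  e = n ∸ 1
  1<e : 1 < e
  1<e = ∸-monoˡ-≤ 1 3≤n
  rows : ∀ x → row γ x ≡ shape 2 0 e e x
  rows x = trans (cong (λ L → at L x) list)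
    (trans (at-blocks 2 0 e (0 ∷ []) (at-replicate-0 1) x) (sym (shape-twos 0 e z≤n x)))
  cond : ShapeCond 2 0 e e
  cond = z≤n , ≤-refl , ≤-refl , inj₂ (inj₂ (inj₁ (≤-trans (s≤s z≤n) 1<e , refl)))
  total : sumBelow (row γ) (suc n) ≡ suc n
  total = trans (sumBelow-head-ones (row γ) 2 0 e z≤n
    (λ x x≤0 → trans (rows x) (shape-first 2 0 e e x x≤0))
    (λ x 0<x x≤e → trans (rows x) (shape-second 2 0 e e x 0<x x≤e))
    (λ x e<x → trans (rows x) (shape-beyond 2 0 e e x z≤n ≤-refl e<x)) (suc n) (s≤s (m∸n≤m n 1)))
    (cong suc (trans (+-comm 1 e) (m∸n+n≡m (≤-trans (s≤s z≤n) 3≤n))))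
exceptional⇒outside-image n 3≤n γ (inj₂ (zero , _ , () , _))
exceptional⇒outside-image n 3≤n γ (inj₂ (suc m , zero , _ , () , _))
exceptional⇒outside-image n 3≤n γ (inj₂ (suc m , suc l , _ , _ , sum-3 , list)) =
  shape⇒joinIrr (suc n) γ (shape-isPartition (suc n) γ 3 m m e₃ cond rows total) 3 m m e₃ cond rows ,
  λ { (α , Jα , η) → NotInImage.¬E2 n 3≤n γ α Jα m l rows η }
  where
  e₃ = m + suc l
  m<e₃ : m < e₃
  m<e₃ = m<m+n m (s≤s z≤n)
  rows : ∀ x → row γ x ≡ shape 3 m m e₃ x
  rows x = trans (cong (λ L → at L x) list) (at-blocks 3 m (suc l) _ (at-replicate-0 (n ∸ (m + suc l))) x)
  cond : ShapeCond 3 m m e₃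
  cond = ≤-refl , <⇒≤ m<e₃ , s≤s (s≤s z≤n) , inj₂ (inj₁ (refl , m<e₃ , ≤-refl))
  total : sumBelow (row γ) (suc n) ≡ suc n
  total = trans (sumBelow-head-ones (row γ) 3 m e₃ (<⇒≤ m<e₃)
    (λ x x≤m → trans (rows x) (shape-first 3 m m e₃ x x≤m))
    (λ x m<x x≤e₃ → trans (rows x) (shape-third 3 m m e₃ x ≤-refl m<x x≤e₃))
    (λ x e₃<x → trans (rows x) (shape-beyond 3 m m e₃ x ≤-refl (<⇒≤ m<e₃) e₃<x))
    (suc n) (≤-trans (+-monoˡ-≤ (suc l) (m≤m+n (suc m) (2 * suc m))) (≤-reflexive sum-3)))
    (trans (cong₂ _+_ (*-comm (suc m) 3) (m+n∸m≡n m (suc l))) sum-3)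

lemma4 : (n : ℕ) → 3 ≤ n → (γ : Vec ℕ (suc n)) →
    (JoinIrr (suc n) γ × ¬ (Σ (Vec ℕ n) λ α → JoinIrr n α × EtaGraph n α γ))
      ⇔ (E1 n γ ⊎ E2 n γ)
lemma4 n 3≤n γ = mk⇔
  (λ (J , ¬img) → Preimage.outside-image⇒exceptional n 3≤n γ (proj₁ J) J ¬img)
  (exceptional⇒outside-image n 3≤n γ)
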